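{- For all integers $n\geq0$ and $1\leq k\leq m$, \[\mathbb{V}^m_{k,n}=p^{ -nm}\sum_{\mu\in\Pi_n(m-k)}(-p^n)^{ -\ell(\mu)}\binom{m-1+\ell(\mu)}{m-1,\ \ell_1(\mu),\dots,\ell_{p^n-1}(\mu)}\prod_{i=1}^{p^n-1}\binom{p^n}{i+1}^{\ell_i(\mu)},\] where the second factor is a multinomial coefficient.
   Context: $p\geq2$ is a fixed integer. For integers $n\geq0$ and $1\leq k\leq m$, the rational numbers $\mathbb{V}^m_{k,n}\in\mathbb{Q}$ are defined as the first $m$ Taylor coefficients at $x=1$ of $(x^{p^n-1}+\dots+x+1)^{ -m}$, namely $(x^{p^n-1}+\dots+x+1)^{ -m}=\sum_{k=1}^m\mathbb{V}^m_{k,n}(x-1)^{m-k}+O((x-1)^m)$. For $k,n\in\mathbb{Z}_{\geq0}$, $\Pi_n(k)$ denotes the set of integer partitions $\mu=(\mu_1,\dots,\mu_\ell)$ of $k$ with greatest part $\mu_1<p^n$; $\ell(\mu):=\ell$ is its length and $\ell_i(\mu)$ the multiplicity of $i$ in $\mu$ for $1\leq i\leq p^n-1$. Conventions: $\Pi_n(0)=\{\emptyset\}$ for every $n\geq0$, $\Pi_0(k)=\emptyset$ for every $k\geq1$, and the empty partition has $\ell(\emptyset)=0$ and $\ell_i(\emptyset)=0$ for all $i$. -}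

module Defs where

open import Data.Nat as ℕ using (ℕ; zero; suc; _∸_; _≤_; _<_)
open import Data.Nat.Combinatorics using (_C_)
import Data.Nat.ListAction as ListAction
open import Data.Integer as ℤ using (ℤ; +_)
open import Data.Rational as ℚ using (ℚ; 0ℚ; 1ℚ; _+_; _*_; -_; _÷_)
open import Data.Rational.Properties using (_≟_)
open import Data.List as List using (List; []; _∷_; map; concatMap; length; upTo; replicate; foldr; filter)
open import Relation.Nullary using (yes; no)
open import Relation.Binary.PropositionalEquality using (_≡_)

ℕ→ℚ : ℕ → ℚ
ℕ→ℚ n = (+ n) ℚ./ 1

-- reciprocal, with the (irrelevant for us) convention recip 0 = 0
recip : ℚ → ℚ
recip q with q ≟ 0ℚ
... | yes _  = 0ℚ
... | no q≢0 = ℚ.1/_ q {{ℚ.≢-nonZero q≢0}}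

_^ℚ_ : ℚ → ℕ → ℚ
q ^ℚ zero  = 1ℚ
q ^ℚ suc k = q * (q ^ℚ k)

Σ≤ : ℕ → (ℕ → ℚ) → ℚ
Σ≤ zero    f = f 0
Σ≤ (suc n) f = Σ≤ n f + f (suc n)

Series : Set
Series = ℕ → ℚ

constS : ℚ → Series
constS a zero    = a
constS a (suc _) = 0ℚ

onePlusT : Series
onePlusT zero          = 1ℚ
onePlusT (suc zero)    = 1ℚ
onePlusT (suc (suc _)) = 0ℚ

_⊕_ : Series → Series → Series
(f ⊕ g) i = f i + g i

negS : Series → Series
negS f i = - f i

scaleS : ℚ → Series → Series
scaleS a f i = a * f i

_⊛_ : Series → Series → Series
(f ⊛ g) i = Σ≤ i (λ j → f j * g (i ∸ j))

powS : Series → ℕ → Series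
powS f zero    = constS 1ℚ
powS f (suc k) = f ⊛ powS f k

-- Multiplicative inverse of a power series f with f 0 ≠ 0:
-- writing f = f₀ (1 + u) with u(0) = 0, we have
-- 1/f = f₀⁻¹ Σ_{j ≥ 0} (-u)^j, and only the terms j ≤ i contribute
-- to the coefficient of t^i.
invS : Series → Series
invS f i = recip (f 0) * Σ≤ i (λ j → powS (negS u) j i)
  where
  u : Series
  u = scaleS (recip (f 0)) f ⊕ negS (constS 1ℚ)

-- A polynomial in x given by its coefficient list [a₀, a₁, …],
-- re-expanded around x = 1, i.e. the series in t of P(1 + t)  (Horner).
polyAt1+t : List ℚ → Series
polyAt1+t []       = constS 0ℚ
polyAt1+t (a ∷ as) = constS a ⊕ (onePlusT ⊛ polyAt1+t as)

geomPoly : ℕ → List ℚ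
geomPoly N = replicate N 1ℚ

-- Taylor expansion at x = 1 of (x^{p^n-1}+…+x+1)^{-m}, as a series in t = x - 1
taylorNegPow : (p n m : ℕ) → Series
taylorNegPow p n m = powS (invS (polyAt1+t (geomPoly (p ℕ.^ n)))) m

𝕍 : (p m k n : ℕ) → ℚ
𝕍 p m k n = taylorNegPow p n m (m ∸ k)

-- partitionsAux fuel b k : all partitions of k (as weakly decreasing lists
-- of positive parts) with every part ≤ b; requires fuel ≥ k.
partitionsAux : ℕ → ℕ → ℕ → List (List ℕ)
partitionsAux _          b zero    = [] ∷ []
partitionsAux zero       b (suc k) = []
partitionsAux (suc fuel) b (suc k) =
  concatMap (λ j → map (suc j ∷_) (partitionsAux fuel (suc j) (suc k ∸ suc j)))
            (upTo (ℕ._⊓_ b (suc k)))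

Π : (p n k : ℕ) → List (List ℕ)
Π p n k = partitionsAux k (p ℕ.^ n ∸ 1) k

ℓ : List ℕ → ℕ
ℓ = length

mult : ℕ → List ℕ → ℕ
mult i μ = length (filter (ℕ._≟_ i) μ)

multinomial : List ℕ → ℕ
multinomial []       = 1
multinomial (k ∷ ks) = ((k ℕ.+ ListAction.sum ks) C k) ℕ.* multinomial ks

range1 : ℕ → List ℕ
range1 N = List.map suc (upTo (N ∸ 1))

summand : (p n m : ℕ) → List ℕ → ℚ
summand p n m μ =
  recip ((- ℕ→ℚ (p ℕ.^ n)) ^ℚ ℓ μ)
  * ℕ→ℚ (multinomial ((m ∸ 1) ∷ map (λ i → mult i μ) (range1 (p ℕ.^ n))))
  * List.foldr _*_ 1ℚ
      (map (λ i → ℕ→ℚ (((p ℕ.^ n) C (suc i)) ℕ.^ mult i μ)) (range1 (p ℕ.^ n)))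

rhs : (p m k n : ℕ) → ℚ
rhs p m k n =
  recip (ℕ→ℚ (p ℕ.^ (n ℕ.* m)))
  * List.foldr _+_ 0ℚ (map (summand p n m) (Π p n (m ∸ k)))

-- Put x = 1 + t. Then 1 + x + ⋯ + x^{N-1} = ((1 + t)ᴺ - 1) / t = N (1 - A) with
-- A = Σ_{1≤j<N} aⱼ tʲ and aⱼ = -C(N, j + 1) / N, so 𝕍 is N⁻ᵐ times a coefficient of (1 - A)⁻ᵐ.
-- Adjoining the monomials of A one at a time, if Y q = (1 - A)⁻ᑫ then
-- (1 - A - v tᴮ)⁻⁽ᑫ⁺¹⁾ = Σᵣ C(q + r, r) vʳ t^{B r} Y (q + r + 1), and grouping the partitions with
-- parts ≤ B by the multiplicity r of B gives the same recursion for the partition sums; both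
-- families are the unique solution of (1 - A) X (q + 1) = X q with X 0 = 1.

module Submission where

open import Defs
open import Data.Nat using (ℕ; _≤_)
open import Data.Rational using (ℚ)
open import Relation.Binary.PropositionalEquality using (_≡_)

open import Data.Nat as ℕ using (zero; suc; _∸_; _<_; z≤n; s≤s)
import Data.Nat.Properties as ℕP
open import Data.Nat.Combinatorics
  using (_C_; nCn≡1; nC1≡n; k>n⇒nCk≡0; nCk+nC[k+1]≡[n+1]C[k+1]; nCk≡n!/k![n-k]!; k![n∸k]!∣n!)
open import Data.Nat.DivMod using (m/n*n≡m)
open import Data.Nat.ListAction using (sum; product)
import Data.Nat.Solver as ℕSolver
import Data.Nat.ListAction.Properties as ℕListP
import Data.Integer as ℤ
import Data.Integer.Properties as ℤP
open import Data.Rational as ℚ using (0ℚ; 1ℚ; _+_; _*_; -_)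
import Data.Rational.Properties as ℚP
import Data.Rational.Unnormalised as ℚᵘ
import Data.Rational.Unnormalised.Properties as ℚᵘP
open import Data.Rational.Solver using (module +-*-Solver)
open import Data.List as List using (List; []; _∷_; _++_; map; foldr; replicate; length; filter; upTo; concatMap)
import Data.List.Properties as ListP
open import Data.List.Relation.Unary.All as All using (All; []; _∷_)
import Data.List.Relation.Unary.All.Properties as AllP
open import Data.Empty using (⊥-elim)
open import Function using (_∘_)
open import Data.Nat.Induction using (<-rec)
open import Relation.Nullary using (yes; no; ¬_; Dec)
open import Relation.Binary.PropositionalEquality
  using (_≗_; refl; sym; trans; cong; cong₂; subst; module ≡-Reasoning)
open ≡-Reasoning
open +-*-Solver
open ℕSolver.+-*-Solver using () renaming (solve to solveℕ; _:+_ to _⊞_; _:*_ to _⊠_; _:=_ to _≐_; con to conℕ)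

ℕ→ℚ-unnormalised : ∀ n → ℚ.toℚᵘ (ℕ→ℚ n) ℚᵘ.≃ ℚᵘ.mkℚᵘ (ℤ.+ n) 0
ℕ→ℚ-unnormalised n = ℚP.toℚᵘ-fromℚᵘ (ℚᵘ.mkℚᵘ (ℤ.+ n) 0)

ℕ→ℚ-homo-+ : ∀ m n → ℕ→ℚ (m ℕ.+ n) ≡ ℕ→ℚ m + ℕ→ℚ n
ℕ→ℚ-homo-+ m n = ℚP.toℚᵘ-injective (begin-≃
  ℚ.toℚᵘ (ℕ→ℚ (m ℕ.+ n))                  ≈⟨ ℕ→ℚ-unnormalised (m ℕ.+ n) ⟩
  ℚᵘ.mkℚᵘ (ℤ.+ (m ℕ.+ n)) 0                ≈⟨ ℚᵘ.*≡* cross ⟩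
  ℚᵘ.mkℚᵘ (ℤ.+ m) 0 ℚᵘ.+ ℚᵘ.mkℚᵘ (ℤ.+ n) 0 ≈⟨ ℚᵘP.+-cong (ℕ→ℚ-unnormalised m)
                                                             (ℕ→ℚ-unnormalised n) ⟨
  ℚ.toℚᵘ (ℕ→ℚ m) ℚᵘ.+ ℚ.toℚᵘ (ℕ→ℚ n)      ≈⟨ ℚP.toℚᵘ-homo-+ (ℕ→ℚ m) (ℕ→ℚ n) ⟨
  ℚ.toℚᵘ (ℕ→ℚ m + ℕ→ℚ n)                  ∎≃)
  where
  open ℚᵘP.≃-Reasoning renaming (begin_ to begin-≃_; _∎ to _∎≃)
  cross : ℤ.+ (m ℕ.+ n) ℤ.* ℤ.+ 1 ≡ (ℤ.+ m ℤ.* ℤ.+ 1 ℤ.+ ℤ.+ n ℤ.* ℤ.+ 1) ℤ.* ℤ.+ 1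
  cross rewrite ℤP.*-identityʳ (ℤ.+ (m ℕ.+ n)) | ℤP.*-identityʳ (ℤ.+ m) | ℤP.*-identityʳ (ℤ.+ n)
              | ℤP.*-identityʳ (ℤ.+ m ℤ.+ ℤ.+ n) = ℤP.pos-+ m n

ℕ→ℚ-homo-* : ∀ m n → ℕ→ℚ (m ℕ.* n) ≡ ℕ→ℚ m * ℕ→ℚ n
ℕ→ℚ-homo-* m n = ℚP.toℚᵘ-injective (begin-≃
  ℚ.toℚᵘ (ℕ→ℚ (m ℕ.* n))                  ≈⟨ ℕ→ℚ-unnormalised (m ℕ.* n) ⟩
  ℚᵘ.mkℚᵘ (ℤ.+ (m ℕ.* n)) 0                ≈⟨ ℚᵘ.*≡* cross ⟩
  ℚᵘ.mkℚᵘ (ℤ.+ m) 0 ℚᵘ.* ℚᵘ.mkℚᵘ (ℤ.+ n) 0 ≈⟨ ℚᵘP.*-cong (ℕ→ℚ-unnormalised m)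
                                                             (ℕ→ℚ-unnormalised n) ⟨
  ℚ.toℚᵘ (ℕ→ℚ m) ℚᵘ.* ℚ.toℚᵘ (ℕ→ℚ n)      ≈⟨ ℚP.toℚᵘ-homo-* (ℕ→ℚ m) (ℕ→ℚ n) ⟨
  ℚ.toℚᵘ (ℕ→ℚ m * ℕ→ℚ n)                  ∎≃)
  where
  open ℚᵘP.≃-Reasoning renaming (begin_ to begin-≃_; _∎ to _∎≃)
  cross : ℤ.+ (m ℕ.* n) ℤ.* ℤ.+ 1 ≡ (ℤ.+ m ℤ.* ℤ.+ n) ℤ.* ℤ.+ 1
  cross = cong (ℤ._* ℤ.+ 1) (ℤP.pos-* m n)

ℕ→ℚ-suc≢0 : ∀ n → ¬ ℕ→ℚ (suc n) ≡ 0ℚ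
ℕ→ℚ-suc≢0 n eq
  with ℚᵘP.drop-*≡* (ℚᵘP.≃-trans (ℚᵘP.≃-sym (ℕ→ℚ-unnormalised (suc n)))
                                 (ℚᵘP.≃-reflexive (cong ℚ.toℚᵘ eq)))
... | ()

^ℚ-distribˡ-+-* : ∀ x a b → x ^ℚ (a ℕ.+ b) ≡ x ^ℚ a * x ^ℚ b
^ℚ-distribˡ-+-* x zero    b = sym (ℚP.*-identityˡ _)
^ℚ-distribˡ-+-* x (suc a) b = trans (cong (x *_) (^ℚ-distribˡ-+-* x a b)) (sym (ℚP.*-assoc x _ _))

^ℚ-distribʳ-* : ∀ x y a → (x * y) ^ℚ a ≡ x ^ℚ a * y ^ℚ a
^ℚ-distribʳ-* x y zero = refl
^ℚ-distribʳ-* x y (suc a) rewrite ^ℚ-distribʳ-* x y a =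
  solve 4 (λ x y u v → (x :* y) :* (u :* v) := (x :* u) :* (y :* v)) refl x y (x ^ℚ a) (y ^ℚ a)

^ℚ-zeroˡ : ∀ a → 1ℚ ^ℚ a ≡ 1ℚ
^ℚ-zeroˡ zero = refl
^ℚ-zeroˡ (suc a) rewrite ^ℚ-zeroˡ a = refl

ℕ→ℚ-homo-^ : ∀ a r → ℕ→ℚ (a ℕ.^ r) ≡ ℕ→ℚ a ^ℚ r
ℕ→ℚ-homo-^ a zero    = refl
ℕ→ℚ-homo-^ a (suc r) = trans (ℕ→ℚ-homo-* a (a ℕ.^ r)) (cong (ℕ→ℚ a *_) (ℕ→ℚ-homo-^ a r))

recip-nonZero : ∀ q (q≢0 : ¬ q ≡ 0ℚ) → recip q ≡ ℚ.1/_ q {{ℚ.≢-nonZero q≢0}}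
recip-nonZero q q≢0 with q ℚP.≟ 0ℚ
... | yes q≡0 = ⊥-elim (q≢0 q≡0)
... | no _    = refl

recip-inverseˡ : ∀ q → ¬ q ≡ 0ℚ → recip q * q ≡ 1ℚ
recip-inverseˡ q q≢0 rewrite recip-nonZero q q≢0 = ℚP.*-inverseˡ q {{ℚ.≢-nonZero q≢0}}

recip-unique : ∀ x a → ¬ x ≡ 0ℚ → a * x ≡ 1ℚ → recip x ≡ a
recip-unique x a x≢0 ax≡1 = begin
  recip x             ≡⟨ ℚP.*-identityˡ (recip x) ⟨
  1ℚ * recip x        ≡⟨ cong (_* recip x) ax≡1 ⟨
  (a * x) * recip x   ≡⟨ ℚP.*-assoc a x (recip x) ⟩
  a * (x * recip x)   ≡⟨ cong (a *_) (trans (ℚP.*-comm x (recip x)) (recip-inverseˡ x x≢0)) ⟩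
  a * 1ℚ              ≡⟨ ℚP.*-identityʳ a ⟩
  a                   ∎

*≡1⇒≢0 : ∀ a x → a * x ≡ 1ℚ → ¬ x ≡ 0ℚ
*≡1⇒≢0 a x ax≡1 x≡0 = ℚP.1≢0 (trans (sym ax≡1) (trans (cong (a *_) x≡0) (ℚP.*-zeroʳ a)))

recip-^ℚ : ∀ x m → ¬ x ≡ 0ℚ → recip (x ^ℚ m) ≡ recip x ^ℚ m
recip-^ℚ x m x≢0 = recip-unique (x ^ℚ m) (recip x ^ℚ m) (*≡1⇒≢0 (recip x ^ℚ m) (x ^ℚ m) inverse) inverse
  where
  inverse : recip x ^ℚ m * x ^ℚ m ≡ 1ℚ
  inverse = trans (sym (^ℚ-distribʳ-* (recip x) x m))
                  (trans (cong (_^ℚ m) (recip-inverseˡ x x≢0)) (^ℚ-zeroˡ m))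

recip-neg : ∀ x → ¬ x ≡ 0ℚ → recip (- x) ≡ - recip x
recip-neg x x≢0 = recip-unique (- x) (- recip x) (*≡1⇒≢0 (- recip x) (- x) inverse) inverse
  where
  inverse : - recip x * - x ≡ 1ℚ
  inverse = trans (solve 2 (λ a b → (:- a) :* (:- b) := a :* b) refl (recip x) x) (recip-inverseˡ x x≢0)

Σ≤-cong : ∀ n {f g : ℕ → ℚ} → (∀ j → j ≤ n → f j ≡ g j) → Σ≤ n f ≡ Σ≤ n g
Σ≤-cong zero    f≡g = f≡g 0 z≤n
Σ≤-cong (suc n) f≡g =
  cong₂ _+_ (Σ≤-cong n (λ j j≤n → f≡g j (ℕP.m≤n⇒m≤1+n j≤n))) (f≡g (suc n) ℕP.≤-refl)

Σ≤-cong′ : ∀ n {f g : ℕ → ℚ} → f ≗ g → Σ≤ n f ≡ Σ≤ n g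
Σ≤-cong′ n f≗g = Σ≤-cong n (λ j _ → f≗g j)

Σ≤-+ : ∀ n (f g : ℕ → ℚ) → Σ≤ n (λ j → f j + g j) ≡ Σ≤ n f + Σ≤ n g
Σ≤-+ zero    f g = refl
Σ≤-+ (suc n) f g rewrite Σ≤-+ n f g =
  solve 4 (λ a b c d → (a :+ b) :+ (c :+ d) := (a :+ c) :+ (b :+ d)) refl (Σ≤ n f) (Σ≤ n g) (f (suc n)) (g (suc n))

Σ≤-*ˡ : ∀ n c (f : ℕ → ℚ) → Σ≤ n (λ j → c * f j) ≡ c * Σ≤ n f
Σ≤-*ˡ zero    c f = refl
Σ≤-*ˡ (suc n) c f rewrite Σ≤-*ˡ n c f = sym (ℚP.*-distribˡ-+ c (Σ≤ n f) (f (suc n)))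

Σ≤-*ʳ : ∀ n c (f : ℕ → ℚ) → Σ≤ n (λ j → f j * c) ≡ Σ≤ n f * c
Σ≤-*ʳ n c f = trans (Σ≤-cong′ n (λ j → ℚP.*-comm (f j) c)) (trans (Σ≤-*ˡ n c f) (ℚP.*-comm c _))

Σ≤-zero : ∀ n {f : ℕ → ℚ} → (∀ j → j ≤ n → f j ≡ 0ℚ) → Σ≤ n f ≡ 0ℚ
Σ≤-zero n f≡0 = trans (Σ≤-cong n f≡0) (Σ≤-constant-zero n)
  where
  Σ≤-constant-zero : ∀ n → Σ≤ n (λ _ → 0ℚ) ≡ 0ℚ
  Σ≤-constant-zero zero    = refl
  Σ≤-constant-zero (suc n) rewrite Σ≤-constant-zero n = refl

Σ≤-swap : ∀ n m (F : ℕ → ℕ → ℚ) → Σ≤ n (λ i → Σ≤ m (F i)) ≡ Σ≤ m (λ j → Σ≤ n (λ i → F i j))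
Σ≤-swap zero    m F = refl
Σ≤-swap (suc n) m F rewrite Σ≤-swap n m F = sym (Σ≤-+ m (λ j → Σ≤ n (λ i → F i j)) (F (suc n)))

Σ≤-zeroTail : ∀ {m} n {f : ℕ → ℚ} → m ≤ n → (∀ j → m < j → j ≤ n → f j ≡ 0ℚ) → Σ≤ n f ≡ Σ≤ m f
Σ≤-zeroTail         zero    z≤n tail≡0 = refl
Σ≤-zeroTail {m} (suc n) {f} m≤1+n tail≡0 with m ℕ.≟ suc n
... | yes refl = refl
... | no m≢1+n = begin
  Σ≤ n f + f (suc n) ≡⟨ cong₂ _+_ (Σ≤-zeroTail n (ℕP.≤-pred m<1+n) (λ j m<j j≤n →
                                    tail≡0 j m<j (ℕP.m≤n⇒m≤1+n j≤n)))
                                  (tail≡0 (suc n) m<1+n ℕP.≤-refl) ⟩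
  Σ≤ m f + 0ℚ        ≡⟨ ℚP.+-identityʳ _ ⟩
  Σ≤ m f             ∎
  where m<1+n = ℕP.≤∧≢⇒< m≤1+n m≢1+n

Σ≤-head : ∀ n (f : ℕ → ℚ) → Σ≤ (suc n) f ≡ f 0 + Σ≤ n (f ∘ suc)
Σ≤-head zero    f = refl
Σ≤-head (suc n) f rewrite Σ≤-head n f = ℚP.+-assoc (f 0) _ _

Σ≤-single : ∀ {k} n {f : ℕ → ℚ} → k ≤ n → (∀ j → j ≤ n → ¬ j ≡ k → f j ≡ 0ℚ) → Σ≤ n f ≡ f k
Σ≤-single {k} n {f} k≤n others≡0 =
  trans (Σ≤-zeroTail n k≤n (λ j k<j j≤n → others≡0 j j≤n (ℕP.>⇒≢ k<j))) (Σ≤-last k below≡0)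
  where
  below≡0 : ∀ j → j < k → f j ≡ 0ℚ
  below≡0 j j<k = others≡0 j (ℕP.≤-trans (ℕP.<⇒≤ j<k) k≤n) (ℕP.<⇒≢ j<k)
  Σ≤-last : ∀ k → (∀ j → j < k → f j ≡ 0ℚ) → Σ≤ k f ≡ f k
  Σ≤-last zero    _       = refl
  Σ≤-last (suc k) below≡0 = trans (cong (_+ f (suc k)) (Σ≤-zero k (λ j j≤k → below≡0 j (s≤s j≤k))))
                                  (ℚP.+-identityˡ (f (suc k)))

Σ≤-head-only : ∀ n {f : ℕ → ℚ} → (∀ j → f (suc j) ≡ 0ℚ) → Σ≤ n f ≡ f 0
Σ≤-head-only n tail≡0 = Σ≤-single n z≤n (λ { zero _ 0≢0 → ⊥-elim (0≢0 refl) ; (suc j) _ _ → tail≡0 j })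

Σ≤-triangle : ∀ n (T : ℕ → ℕ → ℚ) →
  Σ≤ n (λ s → Σ≤ s (λ j → T j s)) ≡ Σ≤ n (λ j → Σ≤ (n ∸ j) (λ l → T j (j ℕ.+ l)))
Σ≤-triangle zero    T = refl
Σ≤-triangle (suc n) T = begin
  Σ≤ n (λ s → Σ≤ s (λ j → T j s)) + (Σ≤ n (λ j → T j (suc n)) + T (suc n) (suc n))
    ≡⟨ cong (_+ (Σ≤ n (λ j → T j (suc n)) + T (suc n) (suc n))) (Σ≤-triangle n T) ⟩
  Σ≤ n row + (Σ≤ n (λ j → T j (suc n)) + T (suc n) (suc n))
    ≡⟨ ℚP.+-assoc (Σ≤ n row) _ _ ⟨
  (Σ≤ n row + Σ≤ n (λ j → T j (suc n))) + T (suc n) (suc n)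
    ≡⟨ cong₂ _+_ (trans (sym (Σ≤-+ n _ _)) (Σ≤-cong n extendRow)) (cong (T (suc n)) (sym (ℕP.+-identityʳ (suc n)))) ⟩
  Σ≤ n row′ + T (suc n) (suc n ℕ.+ 0)
    ≡⟨ cong (λ z → Σ≤ n row′ + Σ≤ z (λ l → T (suc n) (suc n ℕ.+ l))) (sym (ℕP.n∸n≡0 (suc n))) ⟩
  Σ≤ (suc n) row′ ∎
  where
  row row′ : ℕ → ℚ
  row  j = Σ≤ (n ∸ j) (λ l → T j (j ℕ.+ l))
  row′ j = Σ≤ (suc n ∸ j) (λ l → T j (j ℕ.+ l))
  extendRow : ∀ j → j ≤ n → row j + T j (suc n) ≡ row′ j
  extendRow j j≤n rewrite ℕP.+-∸-assoc 1 j≤n =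
    cong (row j +_) (cong (T j) (sym (trans (ℕP.+-suc j (n ∸ j)) (cong suc (ℕP.m+[n∸m]≡n j≤n)))))

⊛-congˡ : ∀ {f f′} g → f ≗ f′ → (f ⊛ g) ≗ (f′ ⊛ g)
⊛-congˡ g f≗f′ i = Σ≤-cong′ i (λ j → cong (_* g (i ∸ j)) (f≗f′ j))

⊛-congʳ : ∀ f {g g′} → g ≗ g′ → (f ⊛ g) ≗ (f ⊛ g′)
⊛-congʳ f g≗g′ i = Σ≤-cong′ i (λ j → cong (f j *_) (g≗g′ (i ∸ j)))

⊛-assoc : ∀ f g h → (f ⊛ (g ⊛ h)) ≗ ((f ⊛ g) ⊛ h)
⊛-assoc f g h i = sym (begin
  Σ≤ i (λ s → Σ≤ s (λ j → f j * g (s ∸ j)) * h (i ∸ s))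
    ≡⟨ Σ≤-cong′ i (λ s → sym (Σ≤-*ʳ s (h (i ∸ s)) (λ j → f j * g (s ∸ j)))) ⟩
  Σ≤ i (λ s → Σ≤ s (λ j → f j * g (s ∸ j) * h (i ∸ s)))
    ≡⟨ Σ≤-triangle i (λ j s → f j * g (s ∸ j) * h (i ∸ s)) ⟩
  Σ≤ i (λ j → Σ≤ (i ∸ j) (λ l → f j * g (j ℕ.+ l ∸ j) * h (i ∸ (j ℕ.+ l))))
    ≡⟨ Σ≤-cong′ i (λ j → trans (Σ≤-cong′ (i ∸ j) (λ l → trans
          (cong₂ (λ a b → f j * g a * h b) (ℕP.m+n∸m≡n j l) (sym (ℕP.∸-+-assoc i j l)))
          (ℚP.*-assoc (f j) _ _)))
       (Σ≤-*ˡ (i ∸ j) (f j) (λ l → g l * h (i ∸ j ∸ l)))) ⟩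
  Σ≤ i (λ j → f j * Σ≤ (i ∸ j) (λ l → g l * h (i ∸ j ∸ l))) ∎)

⊛-distribʳ-⊕ : ∀ f g h → ((f ⊕ g) ⊛ h) ≗ ((f ⊛ h) ⊕ (g ⊛ h))
⊛-distribʳ-⊕ f g h i = trans (Σ≤-cong′ i (λ j → ℚP.*-distribʳ-+ (h (i ∸ j)) (f j) (g j))) (Σ≤-+ i _ _)

⊛-scaleˡ : ∀ c f h → (scaleS c f ⊛ h) ≗ scaleS c (f ⊛ h)
⊛-scaleˡ c f h i = trans (Σ≤-cong′ i (λ j → ℚP.*-assoc c (f j) (h (i ∸ j)))) (Σ≤-*ˡ i c _)

⊛-scaleʳ : ∀ c f h → (f ⊛ scaleS c h) ≗ scaleS c (f ⊛ h)
⊛-scaleʳ c f h i =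
  trans (Σ≤-cong′ i (λ j → solve 3 (λ a b x → a :* (b :* x) := b :* (a :* x)) refl (f j) c (h (i ∸ j))))
        (Σ≤-*ˡ i c _)

⊛-identityˡ : ∀ h → (constS 1ℚ ⊛ h) ≗ h
⊛-identityˡ h i = trans (Σ≤-head-only i (λ j → ℚP.*-zeroˡ (h (i ∸ suc j)))) (ℚP.*-identityˡ (h i))

powS-scale : ∀ c f m → powS (scaleS c f) m ≗ scaleS (c ^ℚ m) (powS f m)
powS-scale c f zero    i = sym (ℚP.*-identityˡ _)
powS-scale c f (suc m) i = begin
  (scaleS c f ⊛ powS (scaleS c f) m) i          ≡⟨ ⊛-congʳ (scaleS c f) (powS-scale c f m) i ⟩
  (scaleS c f ⊛ scaleS (c ^ℚ m) (powS f m)) i   ≡⟨ ⊛-scaleˡ c f (scaleS (c ^ℚ m) (powS f m)) i ⟩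
  c * (f ⊛ scaleS (c ^ℚ m) (powS f m)) i        ≡⟨ cong (c *_) (⊛-scaleʳ (c ^ℚ m) f (powS f m) i) ⟩
  c * ((c ^ℚ m) * (f ⊛ powS f m) i)             ≡⟨ ℚP.*-assoc c _ _ ⟨
  (c ^ℚ suc m) * powS f (suc m) i               ∎

powS-vanishes-below : ∀ A → A 0 ≡ 0ℚ → ∀ j t → t < j → powS A j t ≡ 0ℚ
powS-vanishes-below A A0≡0 (suc j) t t<1+j = Σ≤-zero t (term t t<1+j)
  where
  term : ∀ t → t < suc j → ∀ l → l ≤ t → A l * powS A j (t ∸ l) ≡ 0ℚ
  term t _ zero _ rewrite A0≡0 = ℚP.*-zeroˡ (powS A j t)
  term (suc t) (s≤s t<j) (suc l) _ =
    trans (cong (A (suc l) *_) (powS-vanishes-below A A0≡0 j (t ∸ l) (ℕP.≤-<-trans (ℕP.m∸n≤m t l) t<j)))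
          (ℚP.*-zeroʳ (A (suc l)))

-- Σⱼ Aʲ = (1 - A)⁻¹; for A 0 = 0 only the terms j ≤ i reach the coefficient of tⁱ.
geometric : Series → Series
geometric A i = Σ≤ i (λ j → powS A j i)

geometric-unfold : ∀ A → A 0 ≡ 0ℚ → geometric A ≗ (constS 1ℚ ⊕ (A ⊛ geometric A))
geometric-unfold A A0≡0 i = begin
  Σ≤ i P                       ≡⟨ ℚP.+-identityʳ _ ⟨
  Σ≤ i P + 0ℚ                  ≡⟨ cong (Σ≤ i P +_) (powS-vanishes-below A A0≡0 (suc i) i ℕP.≤-refl) ⟨
  Σ≤ (suc i) P                 ≡⟨ Σ≤-head i P ⟩
  P 0 + Σ≤ i (P ∘ suc)         ≡⟨ cong (P 0 +_) convolution ⟨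
  P 0 + (A ⊛ geometric A) i    ∎
  where
  P : ℕ → ℚ
  P j = powS A j i
  convolution : (A ⊛ geometric A) i ≡ Σ≤ i (P ∘ suc)
  convolution = begin
    Σ≤ i (λ l → A l * Σ≤ (i ∸ l) (λ j → powS A j (i ∸ l)))
      ≡⟨ Σ≤-cong′ i (λ l → cong (A l *_) (sym (Σ≤-zeroTail i (ℕP.m∸n≤m i l)
           (λ j i∸l<j _ → powS-vanishes-below A A0≡0 j (i ∸ l) i∸l<j)))) ⟩
    Σ≤ i (λ l → A l * Σ≤ i (λ j → powS A j (i ∸ l)))
      ≡⟨ Σ≤-cong′ i (λ l → sym (Σ≤-*ˡ i (A l) _)) ⟩
    Σ≤ i (λ l → Σ≤ i (λ j → A l * powS A j (i ∸ l)))
      ≡⟨ Σ≤-swap i i _ ⟩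
    Σ≤ i (P ∘ suc) ∎

-- X q plays the role of (1 - A)⁻ᑫ: multiplying X (q + 1) by 1 - A gives X q.
InvPowers : Series → (ℕ → Series) → Set
InvPowers A X = ∀ q d → X (suc q) d ≡ X q d + (A ⊛ X (suc q)) d

InvPowers-congˡ : ∀ {A A′ X} → A ≗ A′ → InvPowers A X → InvPowers A′ X
InvPowers-congˡ {X = X} A≗A′ invX q d = trans (invX q d) (cong (X q d +_) (⊛-congˡ (X (suc q)) A≗A′ d))

InvPowers-congʳ : ∀ {A X X′} → (∀ q → X q ≗ X′ q) → InvPowers A X′ → InvPowers A X
InvPowers-congʳ {A} {X} {X′} X≗X′ invX′ q d = begin
  X (suc q) d                    ≡⟨ X≗X′ (suc q) d ⟩
  X′ (suc q) d                   ≡⟨ invX′ q d ⟩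
  X′ q d + (A ⊛ X′ (suc q)) d    ≡⟨ cong₂ _+_ (X≗X′ q d) (⊛-congʳ A (X≗X′ (suc q)) d) ⟨
  X q d + (A ⊛ X (suc q)) d      ∎

-- Since A 0 = 0, the coefficient of tᵈ in X (q + 1) is determined by X q and lower coefficients.
InvPowers-unique : ∀ {A X X′} → A 0 ≡ 0ℚ → InvPowers A X → InvPowers A X′ → X 0 ≗ X′ 0 → ∀ q → X q ≗ X′ q
InvPowers-unique                  A0≡0 invX invX′ X0≗X′0 zero    = X0≗X′0
InvPowers-unique {A} {X} {X′} A0≡0 invX invX′ X0≗X′0 (suc q) = <-rec _ coefficient
  where
  coefficient : ∀ d → (∀ {e} → e < d → X (suc q) e ≡ X′ (suc q) e) → X (suc q) d ≡ X′ (suc q) d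
  coefficient d lower = begin
    X (suc q) d
      ≡⟨ invX q d ⟩
    X q d + (A ⊛ X (suc q)) d
      ≡⟨ cong₂ _+_ (InvPowers-unique {A} {X} {X′} A0≡0 invX invX′ X0≗X′0 q d) (Σ≤-cong d term) ⟩
    X′ q d + (A ⊛ X′ (suc q)) d
      ≡⟨ invX′ q d ⟨
    X′ (suc q) d ∎
    where
    term : ∀ j → j ≤ d → A j * X (suc q) (d ∸ j) ≡ A j * X′ (suc q) (d ∸ j)
    term zero    _      rewrite A0≡0 = trans (ℚP.*-zeroˡ (X (suc q) d)) (sym (ℚP.*-zeroˡ (X′ (suc q) d)))
    term (suc j) 1+j≤d = cong (A (suc j) *_) (lower (ℕP.∸-monoʳ-< (s≤s z≤n) 1+j≤d))

powS-geometric-invPowers : ∀ A → A 0 ≡ 0ℚ → InvPowers A (powS (geometric A))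
powS-geometric-invPowers A A0≡0 q d = begin
  (geometric A ⊛ F) d
    ≡⟨ ⊛-congˡ F (geometric-unfold A A0≡0) d ⟩
  ((constS 1ℚ ⊕ (A ⊛ geometric A)) ⊛ F) d
    ≡⟨ ⊛-distribʳ-⊕ (constS 1ℚ) (A ⊛ geometric A) F d ⟩
  (constS 1ℚ ⊛ F) d + ((A ⊛ geometric A) ⊛ F) d
    ≡⟨ cong₂ _+_ (⊛-identityˡ F d) (sym (⊛-assoc A (geometric A) F d)) ⟩
  F d + (A ⊛ (geometric A ⊛ F)) d ∎
  where F = powS (geometric A) q

guard≤ : ℕ → ℕ → ℚ → ℚ
guard≤ x d v with x ℕ.≤? d
... | yes _ = v
... | no _  = 0ℚ

guard≤-yes : ∀ {x d} v → x ≤ d → guard≤ x d v ≡ v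
guard≤-yes {x} {d} v x≤d with x ℕ.≤? d
... | yes _   = refl
... | no  x≰d = ⊥-elim (x≰d x≤d)

guard≤-no : ∀ {x d} v → ¬ x ≤ d → guard≤ x d v ≡ 0ℚ
guard≤-no {x} {d} v x≰d with x ℕ.≤? d
... | yes x≤d = ⊥-elim (x≰d x≤d)
... | no  _   = refl

guard≤-cong : ∀ x d {u v} → (x ≤ d → u ≡ v) → guard≤ x d u ≡ guard≤ x d v
guard≤-cong x d u≡v with x ℕ.≤? d
... | yes x≤d = u≡v x≤d
... | no  _   = refl

guard≤-+ : ∀ x d u v → guard≤ x d (u + v) ≡ guard≤ x d u + guard≤ x d v
guard≤-+ x d u v with x ℕ.≤? d
... | yes _ = refl
... | no  _ = refl

guard≤-* : ∀ x d c v → guard≤ x d (c * v) ≡ c * guard≤ x d v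
guard≤-* x d c v with x ℕ.≤? d
... | yes _ = refl
... | no  _ = sym (ℚP.*-zeroʳ c)

guard≤-0ℚ : ∀ x d → guard≤ x d 0ℚ ≡ 0ℚ
guard≤-0ℚ x d with x ℕ.≤? d
... | yes _ = refl
... | no  _ = refl

monomial : ℕ → ℚ → Series
monomial B v i with i ℕ.≟ B
... | yes _ = v
... | no  _ = 0ℚ

monomial-self : ∀ B v → monomial B v B ≡ v
monomial-self B v with B ℕ.≟ B
... | yes _   = refl
... | no  B≢B = ⊥-elim (B≢B refl)

monomial-other : ∀ B v {j} → ¬ j ≡ B → monomial B v j ≡ 0ℚ
monomial-other B v {j} j≢B with j ℕ.≟ B
... | yes j≡B = ⊥-elim (j≢B j≡B)
... | no  _   = refl

monomial-⊛ : ∀ B v X d → (monomial B v ⊛ X) d ≡ guard≤ B d (v * X (d ∸ B))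
monomial-⊛ B v X d = byCases (B ℕ.≤? d)
  where
  vanish : ∀ j → ¬ j ≡ B → monomial B v j * X (d ∸ j) ≡ 0ℚ
  vanish j j≢B = trans (cong (_* X (d ∸ j)) (monomial-other B v j≢B)) (ℚP.*-zeroˡ (X (d ∸ j)))
  byCases : Dec (B ≤ d) → (monomial B v ⊛ X) d ≡ guard≤ B d (v * X (d ∸ B))
  byCases (yes B≤d) = begin
    (monomial B v ⊛ X) d        ≡⟨ Σ≤-single d B≤d (λ j _ → vanish j) ⟩
    monomial B v B * X (d ∸ B)  ≡⟨ cong (_* X (d ∸ B)) (monomial-self B v) ⟩
    v * X (d ∸ B)               ≡⟨ guard≤-yes _ B≤d ⟨
    guard≤ B d (v * X (d ∸ B))  ∎
  byCases (no B≰d) = trans (Σ≤-zero d (λ j j≤d → vanish j (λ j≡B → B≰d (subst (_≤ d) j≡B j≤d))))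
                           (sym (guard≤-no _ B≰d))

m∸n∸o≡m∸o∸n : ∀ m n o → m ∸ n ∸ o ≡ m ∸ o ∸ n
m∸n∸o≡m∸o∸n m n o =
  trans (ℕP.∸-+-assoc m n o) (trans (cong (m ∸_) (ℕP.+-comm n o)) (sym (ℕP.∸-+-assoc m o n)))

m≤o∸n⇒n≤o∸m : ∀ {m n o} → n ≤ o → m ≤ o ∸ n → n ≤ o ∸ m
m≤o∸n⇒n≤o∸m {m} {n} {o} n≤o m≤o∸n =
  ℕP.m+n≤o⇒m≤o∸n n (subst (_≤ o) (ℕP.+-comm m n) (ℕP.m≤o∸n⇒m+n≤o m n≤o m≤o∸n))

guard≤-∸ : ∀ {y d} x v → y ≤ d → guard≤ (y ℕ.+ x) d v ≡ guard≤ x (d ∸ y) v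
guard≤-∸ {y} {d} x v y≤d = byCases (x ℕ.≤? d ∸ y)
  where
  byCases : Dec (x ≤ d ∸ y) → guard≤ (y ℕ.+ x) d v ≡ guard≤ x (d ∸ y) v
  byCases (yes x≤d∸y) = trans (guard≤-yes v (subst (_≤ d) (ℕP.+-comm x y) (ℕP.m≤o∸n⇒m+n≤o x y≤d x≤d∸y)))
                              (sym (guard≤-yes v x≤d∸y))
  byCases (no  x≰d∸y) = trans (guard≤-no v (λ y+x≤d →
                                x≰d∸y (ℕP.m+n≤o⇒m≤o∸n x (subst (_≤ d) (ℕP.+-comm y x) y+x≤d))))
                              (sym (guard≤-no v x≰d∸y))

module MonomialPowers (B : ℕ) (1≤B : 1 ≤ B) where

  r≤B*r : ∀ r → r ≤ B ℕ.* r
  r≤B*r r = subst (_≤ B ℕ.* r) (ℕP.*-identityˡ r) (ℕP.*-monoˡ-≤ r 1≤B)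

  -- The series Σᵣ t^{B r} · T r; since B ≥ 1, the terms r > e do not reach tᵉ.
  Σtᴮʳ : (ℕ → Series) → Series
  Σtᴮʳ T e = Σ≤ e (λ r → guard≤ (B ℕ.* r) e (T r (e ∸ B ℕ.* r)))

  Σtᴮʳ-cong : ∀ {T U} → (∀ r → T r ≗ U r) → Σtᴮʳ T ≗ Σtᴮʳ U
  Σtᴮʳ-cong T≗U e = Σ≤-cong′ e (λ r → cong (guard≤ (B ℕ.* r) e) (T≗U r (e ∸ B ℕ.* r)))

  Σtᴮʳ-⊕ : ∀ T U → Σtᴮʳ (λ r → T r ⊕ U r) ≗ (Σtᴮʳ T ⊕ Σtᴮʳ U)
  Σtᴮʳ-⊕ T U e = trans (Σ≤-cong′ e (λ r → guard≤-+ (B ℕ.* r) e _ _)) (Σ≤-+ e _ _)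

  Σtᴮʳ-scale : ∀ c T → Σtᴮʳ (λ r → scaleS c (T r)) ≗ scaleS c (Σtᴮʳ T)
  Σtᴮʳ-scale c T e = trans (Σ≤-cong′ e (λ r → guard≤-* (B ℕ.* r) e c _)) (Σ≤-*ˡ e c _)

  ⊛-Σtᴮʳ : ∀ A T → (A ⊛ Σtᴮʳ T) ≗ Σtᴮʳ (λ r → A ⊛ T r)
  ⊛-Σtᴮʳ A T d = begin
    Σ≤ d (λ j → A j * Σ≤ (d ∸ j) (term j))
      ≡⟨ Σ≤-cong′ d (λ j → cong (A j *_) (sym (Σ≤-zeroTail d (ℕP.m∸n≤m d j) (λ r d∸j<r _ →
           term≡0 j r (λ Br≤d∸j → ℕP.<⇒≱ d∸j<r (ℕP.≤-trans (r≤B*r r) Br≤d∸j)))))) ⟩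
    Σ≤ d (λ j → A j * Σ≤ d (term j))
      ≡⟨ Σ≤-cong′ d (λ j → sym (Σ≤-*ˡ d (A j) (term j))) ⟩
    Σ≤ d (λ j → Σ≤ d (λ r → A j * term j r))
      ≡⟨ Σ≤-swap d d _ ⟩
    Σ≤ d (λ r → Σ≤ d (λ j → A j * term j r))
      ≡⟨ Σ≤-cong′ d (λ r → column r (B ℕ.* r ℕ.≤? d)) ⟩
    Σtᴮʳ (λ r → A ⊛ T r) d ∎
    where
    term : ℕ → ℕ → ℚ
    term j r = guard≤ (B ℕ.* r) (d ∸ j) (T r (d ∸ j ∸ B ℕ.* r))
    term≡0 : ∀ j r → ¬ B ℕ.* r ≤ d ∸ j → term j r ≡ 0ℚ
    term≡0 j r = guard≤-no (T r (d ∸ j ∸ B ℕ.* r))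
    A*term≡0 : ∀ j r → ¬ B ℕ.* r ≤ d ∸ j → A j * term j r ≡ 0ℚ
    A*term≡0 j r Br≰d∸j = trans (cong (A j *_) (term≡0 j r Br≰d∸j)) (ℚP.*-zeroʳ (A j))
    column : ∀ r → Dec (B ℕ.* r ≤ d) →
             Σ≤ d (λ j → A j * term j r) ≡ guard≤ (B ℕ.* r) d ((A ⊛ T r) (d ∸ B ℕ.* r))
    column r (yes Br≤d) = begin
      Σ≤ d (λ j → A j * term j r)
        ≡⟨ Σ≤-zeroTail d (ℕP.m∸n≤m d (B ℕ.* r)) (λ j d∸Br<j j≤d →
             A*term≡0 j r (λ Br≤d∸j → ℕP.<⇒≱ d∸Br<j (m≤o∸n⇒n≤o∸m j≤d Br≤d∸j))) ⟩
      Σ≤ (d ∸ B ℕ.* r) (λ j → A j * term j r)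
        ≡⟨ Σ≤-cong (d ∸ B ℕ.* r) (λ j j≤d∸Br → cong (A j *_)
             (trans (guard≤-yes _ (m≤o∸n⇒n≤o∸m Br≤d j≤d∸Br)) (cong (T r) (m∸n∸o≡m∸o∸n d j (B ℕ.* r))))) ⟩
      (A ⊛ T r) (d ∸ B ℕ.* r)
        ≡⟨ guard≤-yes _ Br≤d ⟨
      guard≤ (B ℕ.* r) d ((A ⊛ T r) (d ∸ B ℕ.* r)) ∎
    column r (no Br≰d) =
      trans (Σ≤-zero d (λ j _ → A*term≡0 j r (λ Br≤d∸j → Br≰d (ℕP.≤-trans Br≤d∸j (ℕP.m∸n≤m d j)))))
            (sym (guard≤-no _ Br≰d))

  shiftIndex : (ℕ → Series) → ℕ → Series
  shiftIndex H zero    = λ _ → 0ℚ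
  shiftIndex H (suc r) = H r

  tᴮ-Σtᴮʳ : ∀ H d → guard≤ B d (Σtᴮʳ H (d ∸ B)) ≡ Σtᴮʳ (shiftIndex H) d
  tᴮ-Σtᴮʳ H zero = trans (guard≤-no _ (ℕP.<⇒≱ 1≤B)) (sym (guard≤-0ℚ (B ℕ.* 0) 0))
  tᴮ-Σtᴮʳ H d@(suc d′) = byCases (B ℕ.≤? d)
    where
    term : ℕ → ℚ
    term r = guard≤ (B ℕ.* r) d (shiftIndex H r (d ∸ B ℕ.* r))
    B*[1+r]≡B+B*r : ∀ r → B ℕ.* suc r ≡ B ℕ.+ B ℕ.* r
    B*[1+r]≡B+B*r = ℕP.*-suc B
    byCases : Dec (B ≤ d) → guard≤ B d (Σtᴮʳ H (d ∸ B)) ≡ Σtᴮʳ (shiftIndex H) d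
    byCases (yes B≤d) = begin
      guard≤ B d (Σtᴮʳ H (d ∸ B))
        ≡⟨ guard≤-yes _ B≤d ⟩
      Σ≤ (d ∸ B) (λ r → guard≤ (B ℕ.* r) (d ∸ B) (H r (d ∸ B ∸ B ℕ.* r)))
        ≡⟨ Σ≤-cong′ (d ∸ B) raise ⟨
      Σ≤ (d ∸ B) (term ∘ suc)
        ≡⟨ Σ≤-zeroTail d′ (ℕP.∸-monoʳ-≤ d 1≤B) (λ r d∸B<r _ → guard≤-no {B ℕ.* suc r} _ (λ B[1+r]≤d →
             ℕP.<⇒≱ d∸B<r (ℕP.≤-trans (r≤B*r r) (ℕP.m+n≤o⇒m≤o∸n (B ℕ.* r)
               (subst (_≤ d) (trans (B*[1+r]≡B+B*r r) (ℕP.+-comm B (B ℕ.* r))) B[1+r]≤d))))) ⟨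
      Σ≤ d′ (term ∘ suc)
        ≡⟨ ℚP.+-identityˡ _ ⟨
      0ℚ + Σ≤ d′ (term ∘ suc)
        ≡⟨ cong (_+ Σ≤ d′ (term ∘ suc)) (guard≤-0ℚ (B ℕ.* 0) d) ⟨
      term 0 + Σ≤ d′ (term ∘ suc)
        ≡⟨ Σ≤-head d′ term ⟨
      Σ≤ d term ∎
      where
      raise : ∀ r → term (suc r) ≡ guard≤ (B ℕ.* r) (d ∸ B) (H r (d ∸ B ∸ B ℕ.* r))
      raise r = begin
        guard≤ (B ℕ.* suc r) d (H r (d ∸ B ℕ.* suc r))
          ≡⟨ cong (λ x → guard≤ x d (H r (d ∸ x))) (B*[1+r]≡B+B*r r) ⟩
        guard≤ (B ℕ.+ B ℕ.* r) d (H r (d ∸ (B ℕ.+ B ℕ.* r)))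
          ≡⟨ guard≤-∸ (B ℕ.* r) _ B≤d ⟩
        guard≤ (B ℕ.* r) (d ∸ B) (H r (d ∸ (B ℕ.+ B ℕ.* r)))
          ≡⟨ cong (guard≤ (B ℕ.* r) (d ∸ B) ∘ H r) (ℕP.∸-+-assoc d B (B ℕ.* r)) ⟨
        guard≤ (B ℕ.* r) (d ∸ B) (H r (d ∸ B ∸ B ℕ.* r)) ∎
    byCases (no B≰d) = trans (guard≤-no _ B≰d) (sym (Σ≤-zero d vanish))
      where
      vanish : ∀ r → r ≤ d → term r ≡ 0ℚ
      vanish zero    _ = guard≤-0ℚ (B ℕ.* 0) d
      vanish (suc r) _ =
        guard≤-no {B ℕ.* suc r} _ (λ B[1+r]≤d → B≰d (ℕP.≤-trans (ℕP.m≤m*n B (suc r)) B[1+r]≤d))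

  onlyAt0 : Series → ℕ → Series
  onlyAt0 X zero    = X
  onlyAt0 X (suc r) = λ _ → 0ℚ

  Σtᴮʳ-onlyAt0 : ∀ X → Σtᴮʳ (onlyAt0 X) ≗ X
  Σtᴮʳ-onlyAt0 X e = begin
    Σtᴮʳ (onlyAt0 X) e                 ≡⟨ Σ≤-head-only e (λ r → guard≤-0ℚ (B ℕ.* suc r) e) ⟩
    guard≤ (B ℕ.* 0) e (X (e ∸ B ℕ.* 0)) ≡⟨ cong (λ x → guard≤ x e (X (e ∸ x))) (ℕP.*-zeroʳ B) ⟩
    guard≤ 0 e (X e)                   ≡⟨ guard≤-yes (X e) (z≤n {e}) ⟩
    X e                                ∎

-- If Y q = (1 - A)⁻ᑫ then (1 - A - v tᴮ)⁻⁽ᑫ⁺¹⁾ = Σᵣ C(q + r, r) vʳ t^{B r} Y (q + r + 1):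
-- the binomial series of (1 - v tᴮ (1 - A)⁻¹)⁻⁽ᑫ⁺¹⁾.
module AddMonomial (B : ℕ) (1≤B : 1 ≤ B) (A : Series) (Y : ℕ → Series)
                   (invY : InvPowers A Y) (Y0≗1 : Y 0 ≗ constS 1ℚ) (v : ℚ) where
  open MonomialPowers B 1≤B

  coeff : ℕ → ℕ → ℚ
  coeff q r = ℕ→ℚ ((q ℕ.+ r) C r) * (v ^ℚ r)

  Zterm : ℕ → ℕ → Series
  Zterm q r = scaleS (coeff q r) (Y (suc (q ℕ.+ r)))

  Z : ℕ → Series
  Z zero    = constS 1ℚ
  Z (suc q) = Σtᴮʳ (Zterm q)

  Z′ : ℕ → Series
  Z′ q = Σtᴮʳ (λ r → scaleS (coeff q r) (Y (q ℕ.+ r)))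

  vtᴮZ : ℕ → Series
  vtᴮZ q = Σtᴮʳ (shiftIndex (λ r → scaleS v (Zterm q r)))

  Z-unfold : ∀ q → Z (suc q) ≗ (Z′ q ⊕ (A ⊛ Z (suc q)))
  Z-unfold q d = begin
    Z (suc q) d
      ≡⟨ Σtᴮʳ-cong unfoldTerm d ⟩
    Σtᴮʳ (λ r → scaleS (coeff q r) (Y (q ℕ.+ r)) ⊕ (A ⊛ Zterm q r)) d
      ≡⟨ Σtᴮʳ-⊕ (λ r → scaleS (coeff q r) (Y (q ℕ.+ r))) (λ r → A ⊛ Zterm q r) d ⟩
    Z′ q d + Σtᴮʳ (λ r → A ⊛ Zterm q r) d
      ≡⟨ cong (Z′ q d +_) (⊛-Σtᴮʳ A (Zterm q) d) ⟨
    Z′ q d + (A ⊛ Z (suc q)) d ∎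
    where
    unfoldTerm : ∀ r e → Zterm q r e ≡ coeff q r * Y (q ℕ.+ r) e + (A ⊛ Zterm q r) e
    unfoldTerm r e = begin
      c * Y (suc (q ℕ.+ r)) e
        ≡⟨ cong (c *_) (invY (q ℕ.+ r) e) ⟩
      c * (Y (q ℕ.+ r) e + (A ⊛ Y (suc (q ℕ.+ r))) e)
        ≡⟨ ℚP.*-distribˡ-+ c _ _ ⟩
      c * Y (q ℕ.+ r) e + c * (A ⊛ Y (suc (q ℕ.+ r))) e
        ≡⟨ cong (c * Y (q ℕ.+ r) e +_) (⊛-scaleʳ c A (Y (suc (q ℕ.+ r))) e) ⟨
      c * Y (q ℕ.+ r) e + (A ⊛ Zterm q r) e ∎
      where c = coeff q r

  tᴮ-Z : ∀ q d → guard≤ B d (v * Z (suc q) (d ∸ B)) ≡ vtᴮZ q d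
  tᴮ-Z q d = trans (cong (guard≤ B d) (sym (Σtᴮʳ-scale v (Zterm q) (d ∸ B))))
                   (tᴮ-Σtᴮʳ (λ r → scaleS v (Zterm q r)) d)

  -- Termwise this is Pascal's rule C(q + r, r) = C(q - 1 + r, r) + C(q + r - 1, r - 1).
  Z′-pascal : ∀ q → Z′ q ≗ (Z q ⊕ vtᴮZ q)
  Z′-pascal zero d = begin
    Z′ 0 d
      ≡⟨ Σtᴮʳ-cong split d ⟩
    Σtᴮʳ (λ r → onlyAt0 (Y 0) r ⊕ shiftIndex shifted r) d
      ≡⟨ Σtᴮʳ-⊕ (onlyAt0 (Y 0)) (shiftIndex shifted) d ⟩
    Σtᴮʳ (onlyAt0 (Y 0)) d + vtᴮZ 0 d
      ≡⟨ cong (_+ vtᴮZ 0 d) (trans (Σtᴮʳ-onlyAt0 (Y 0) d) (Y0≗1 d)) ⟩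
    constS 1ℚ d + vtᴮZ 0 d ∎
    where
    shifted : ℕ → Series
    shifted r = scaleS v (Zterm 0 r)
    split : ∀ r e → coeff 0 r * Y r e ≡ onlyAt0 (Y 0) r e + shiftIndex shifted r e
    split zero    e = trans (ℚP.*-identityˡ (Y 0 e)) (sym (ℚP.+-identityʳ (Y 0 e)))
    split (suc r) e rewrite nCn≡1 (suc r) | nCn≡1 r =
      solve 3 (λ v w y → (con 1ℚ :* (v :* w)) :* y := con 0ℚ :+ v :* ((con 1ℚ :* w) :* y)) refl v (v ^ℚ r) (Y (suc r) e)
  Z′-pascal (suc q) d =
    trans (Σtᴮʳ-cong split d) (Σtᴮʳ-⊕ (Zterm q) (shiftIndex (λ r → scaleS v (Zterm (suc q) r))) d)
    where
    split : ∀ r e → coeff (suc q) r * Y (suc q ℕ.+ r) e ≡ Zterm q r e + shiftIndex (λ r → scaleS v (Zterm (suc q) r)) r e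
    split zero    e = sym (ℚP.+-identityʳ _)
    split (suc r) e = begin
      C₁ * (v * v ^ℚ r) * Y (suc q ℕ.+ suc r) e
        ≡⟨ cong (λ c → c * (v * v ^ℚ r) * W) pascal ⟩
      (C₂ + C₃) * (v * v ^ℚ r) * W
        ≡⟨ solve 5 (λ a b v w y → (a :+ b) :* (v :* w) :* y
              := a :* (v :* w) :* y :+ v :* (b :* w :* y)) refl C₂ C₃ v (v ^ℚ r) W ⟩
      C₂ * (v * v ^ℚ r) * W + v * (C₃ * v ^ℚ r * W)
        ≡⟨ cong (λ y → C₂ * (v * v ^ℚ r) * W + v * (C₃ * v ^ℚ r * y)) Y-index ⟨
      C₂ * (v * v ^ℚ r) * W + v * (C₃ * v ^ℚ r * Y (suc (suc q ℕ.+ r)) e) ∎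
      where
      W  = Y (suc (q ℕ.+ suc r)) e
      C₁ = ℕ→ℚ ((suc q ℕ.+ suc r) C suc r)
      C₂ = ℕ→ℚ ((q ℕ.+ suc r) C suc r)
      C₃ = ℕ→ℚ ((suc q ℕ.+ r) C r)
      Y-index : Y (suc (suc q ℕ.+ r)) e ≡ W
      Y-index = cong (λ n → Y (suc n) e) (sym (ℕP.+-suc q r))
      pascal : C₁ ≡ C₂ + C₃
      pascal = begin
        C₁
          ≡⟨ cong ℕ→ℚ (nCk+nC[k+1]≡[n+1]C[k+1] (q ℕ.+ suc r) r) ⟨
        ℕ→ℚ ((q ℕ.+ suc r) C r ℕ.+ (q ℕ.+ suc r) C suc r)
          ≡⟨ ℕ→ℚ-homo-+ ((q ℕ.+ suc r) C r) ((q ℕ.+ suc r) C suc r) ⟩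
        ℕ→ℚ ((q ℕ.+ suc r) C r) + C₂
          ≡⟨ cong (λ n → ℕ→ℚ (n C r) + C₂) (ℕP.+-suc q r) ⟩
        C₃ + C₂
          ≡⟨ ℚP.+-comm C₃ C₂ ⟩
        C₂ + C₃ ∎

  Z-invPowers : InvPowers (A ⊕ monomial B v) Z
  Z-invPowers q d = begin
    Z (suc q) d
      ≡⟨ Z-unfold q d ⟩
    Z′ q d + (A ⊛ Zs) d
      ≡⟨ cong (_+ (A ⊛ Zs) d) (Z′-pascal q d) ⟩
    (Z q d + vtᴮZ q d) + (A ⊛ Zs) d
      ≡⟨ cong (λ x → (Z q d + x) + (A ⊛ Zs) d) (tᴮ-Z q d) ⟨
    (Z q d + g) + (A ⊛ Zs) d
      ≡⟨ solve 3 (λ a b c → (a :+ b) :+ c := a :+ (c :+ b)) refl (Z q d) g ((A ⊛ Zs) d) ⟩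
    Z q d + ((A ⊛ Zs) d + g)
      ≡⟨ cong (λ x → Z q d + ((A ⊛ Zs) d + x)) (monomial-⊛ B v Zs d) ⟨
    Z q d + ((A ⊛ Zs) d + (monomial B v ⊛ Zs) d)
      ≡⟨ cong (Z q d +_) (⊛-distribʳ-⊕ A (monomial B v) Zs d) ⟨
    Z q d + ((A ⊕ monomial B v) ⊛ Zs) d ∎
    where
    Zs = Z (suc q)
    g  = guard≤ B d (v * Zs (d ∸ B))

Σ< : ℕ → (ℕ → ℚ) → ℚ
Σ< zero    f = 0ℚ
Σ< (suc n) f = Σ≤ n f

Σ<-suc : ∀ n (f : ℕ → ℚ) → Σ≤ n f ≡ Σ< n f + f n
Σ<-suc zero    f = sym (ℚP.+-identityˡ (f 0))
Σ<-suc (suc n) f = refl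

Σ<-cong : ∀ n {f g : ℕ → ℚ} → (∀ j → j < n → f j ≡ g j) → Σ< n f ≡ Σ< n g
Σ<-cong zero    f≡g = refl
Σ<-cong (suc n) f≡g = Σ≤-cong n (λ j j≤n → f≡g j (s≤s j≤n))

Σ<-*ˡ : ∀ n c (f : ℕ → ℚ) → Σ< n (λ j → c * f j) ≡ c * Σ< n f
Σ<-*ˡ zero    c f = sym (ℚP.*-zeroʳ c)
Σ<-*ˡ (suc n) c f = Σ≤-*ˡ n c f

sumMap : ∀ {X : Set} → (X → ℚ) → List X → ℚ
sumMap F xs = foldr _+_ 0ℚ (map F xs)

sumMap-++ : ∀ {X : Set} (F : X → ℚ) xs ys → sumMap F (xs ++ ys) ≡ sumMap F xs + sumMap F ys
sumMap-++ F []       ys = sym (ℚP.+-identityˡ _)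
sumMap-++ F (x ∷ xs) ys rewrite sumMap-++ F xs ys = sym (ℚP.+-assoc (F x) _ _)

sumMap-map : ∀ {X Y : Set} (F : Y → ℚ) (g : X → Y) xs → sumMap F (map g xs) ≡ sumMap (F ∘ g) xs
sumMap-map F g xs = cong (foldr _+_ 0ℚ) (sym (ListP.map-∘ xs))

sumMap-concatMap : ∀ {X Y : Set} (F : Y → ℚ) (g : X → List Y) xs →
  sumMap F (concatMap g xs) ≡ sumMap (sumMap F ∘ g) xs
sumMap-concatMap F g []       = refl
sumMap-concatMap F g (x ∷ xs) = trans (sumMap-++ F (g x) (concatMap g xs)) (cong (sumMap F (g x) +_) (sumMap-concatMap F g xs))

sumMap-upTo : ∀ (f : ℕ → ℚ) n → sumMap f (upTo n) ≡ Σ< n f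
sumMap-upTo f zero    = refl
sumMap-upTo f (suc n) = begin
  sumMap f (upTo (suc n))             ≡⟨ cong (sumMap f) (ListP.upTo-∷ʳ n) ⟨
  sumMap f (upTo n ++ (n ∷ []))       ≡⟨ sumMap-++ f (upTo n) (n ∷ []) ⟩
  sumMap f (upTo n) + (f n + 0ℚ)      ≡⟨ cong₂ _+_ (sumMap-upTo f n) (ℚP.+-identityʳ (f n)) ⟩
  Σ< n f + f n                        ≡⟨ Σ<-suc n f ⟨
  Σ≤ n f                              ∎

ΣPartitionsAux : ℕ → ℕ → ℕ → (List ℕ → ℚ) → ℚ
ΣPartitionsAux _          b zero    F = F []
ΣPartitionsAux zero       b (suc k) F = 0ℚ
ΣPartitionsAux (suc fuel) b (suc k) F =
  Σ< (b ℕ.⊓ suc k) (λ j → ΣPartitionsAux fuel (suc j) (suc k ∸ suc j) (F ∘ (suc j ∷_)))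

sumMap-partitionsAux : ∀ fuel b k F → sumMap F (partitionsAux fuel b k) ≡ ΣPartitionsAux fuel b k F
sumMap-partitionsAux _          b zero    F = ℚP.+-identityʳ (F [])
sumMap-partitionsAux zero       b (suc k) F = refl
sumMap-partitionsAux (suc fuel) b (suc k) F = begin
  sumMap F (concatMap parts (upTo (b ℕ.⊓ suc k)))
    ≡⟨ sumMap-concatMap F parts (upTo (b ℕ.⊓ suc k)) ⟩
  sumMap (sumMap F ∘ parts) (upTo (b ℕ.⊓ suc k))
    ≡⟨ sumMap-upTo (sumMap F ∘ parts) (b ℕ.⊓ suc k) ⟩
  Σ< (b ℕ.⊓ suc k) (sumMap F ∘ parts)
    ≡⟨ Σ<-cong (b ℕ.⊓ suc k) (λ j _ →
         trans (sumMap-map F (suc j ∷_) (partitionsAux fuel (suc j) (k ∸ j)))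
               (sumMap-partitionsAux fuel (suc j) (k ∸ j) (F ∘ (suc j ∷_)))) ⟩
  ΣPartitionsAux (suc fuel) b (suc k) F ∎
  where
  parts : ℕ → List (List ℕ)
  parts j = map (suc j ∷_) (partitionsAux fuel (suc j) (suc k ∸ suc j))

ΣPartitionsAux-fuel : ∀ fuel fuel′ b k F → k ≤ fuel → k ≤ fuel′ →
  ΣPartitionsAux fuel b k F ≡ ΣPartitionsAux fuel′ b k F
ΣPartitionsAux-fuel _          _           b zero    F _         _          = refl
ΣPartitionsAux-fuel (suc fuel) (suc fuel′) b (suc k) F (s≤s k≤f) (s≤s k≤f′) =
  Σ<-cong (b ℕ.⊓ suc k) (λ j _ → ΣPartitionsAux-fuel fuel fuel′ (suc j) (k ∸ j) _
    (ℕP.≤-trans (ℕP.m∸n≤m k j) k≤f) (ℕP.≤-trans (ℕP.m∸n≤m k j) k≤f′))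

ΣPartitionsAux-cong : ∀ fuel b k {F G} → (∀ μ → All (_≤ b) μ → F μ ≡ G μ) →
  ΣPartitionsAux fuel b k F ≡ ΣPartitionsAux fuel b k G
ΣPartitionsAux-cong _          b zero    F≡G = F≡G [] []
ΣPartitionsAux-cong zero       b (suc k) F≡G = refl
ΣPartitionsAux-cong (suc fuel) b (suc k) F≡G =
  Σ<-cong (b ℕ.⊓ suc k) (λ j j<b⊓1+k → ΣPartitionsAux-cong fuel (suc j) (k ∸ j)
    (λ μ μ≤1+j → F≡G (suc j ∷ μ) (1+j≤b j<b⊓1+k ∷ All.map (λ i≤1+j → ℕP.≤-trans i≤1+j (1+j≤b j<b⊓1+k)) μ≤1+j)))
  where
  1+j≤b : ∀ {j} → j < b ℕ.⊓ suc k → suc j ≤ b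
  1+j≤b = ℕP.m<n⊓o⇒m<n b (suc k)

ΣPartitionsAux-*ˡ : ∀ fuel b k c F → ΣPartitionsAux fuel b k (λ μ → c * F μ) ≡ c * ΣPartitionsAux fuel b k F
ΣPartitionsAux-*ˡ _          b zero    c F = refl
ΣPartitionsAux-*ˡ zero       b (suc k) c F = sym (ℚP.*-zeroʳ c)
ΣPartitionsAux-*ˡ (suc fuel) b (suc k) c F =
  trans (Σ<-cong (b ℕ.⊓ suc k) (λ j _ → ΣPartitionsAux-*ˡ fuel (suc j) (k ∸ j) c _)) (Σ<-*ˡ (b ℕ.⊓ suc k) c _)

ΣPartitions : ℕ → ℕ → (List ℕ → ℚ) → ℚ
ΣPartitions b d F = ΣPartitionsAux d b d F

-- Split off the partitions whose largest part is b + 1.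
ΣPartitions-suc : ∀ b d F →
  ΣPartitions (suc b) d F ≡ ΣPartitions b d F + guard≤ (suc b) d (ΣPartitions (suc b) (d ∸ suc b) (F ∘ (suc b ∷_)))
ΣPartitions-suc b zero F =
  sym (trans (cong (F [] +_) (guard≤-no {suc b} {0} (ΣPartitions (suc b) 0 (F ∘ (suc b ∷_))) (λ ())))
             (ℚP.+-identityʳ (F [])))
ΣPartitions-suc b (suc k) F with b ℕ.≤? k
... | yes b≤k rewrite ℕP.m≤n⇒m⊓n≡m b≤k | ℕP.m≤n⇒m⊓n≡m (ℕP.m≤n⇒m≤1+n b≤k) = begin
  Σ≤ b part                                                           ≡⟨ Σ<-suc b part ⟩
  Σ< b part + part b                                                  ≡⟨ cong (Σ< b part +_) largest ⟩
  Σ< b part + guard≤ (suc b) (suc k) (ΣPartitions (suc b) (k ∸ b) (F ∘ (suc b ∷_))) ∎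
  where
  part : ℕ → ℚ
  part j = ΣPartitionsAux k (suc j) (k ∸ j) (F ∘ (suc j ∷_))
  largest : part b ≡ guard≤ (suc b) (suc k) (ΣPartitions (suc b) (k ∸ b) (F ∘ (suc b ∷_)))
  largest = trans (ΣPartitionsAux-fuel k (k ∸ b) (suc b) (k ∸ b) _ (ℕP.m∸n≤m k b) ℕP.≤-refl)
                  (sym (guard≤-yes _ (s≤s b≤k)))
... | no b≰k rewrite ℕP.m≥n⇒m⊓n≡n (ℕP.≰⇒≥ b≰k) | ℕP.m≥n⇒m⊓n≡n (ℕP.≰⇒> b≰k) =
  sym (trans (cong (Σ≤ k (λ j → ΣPartitionsAux k (suc j) (k ∸ j) (F ∘ (suc j ∷_))) +_)
                   (guard≤-no {suc b} _ (λ 1+b≤1+k → b≰k (ℕP.≤-pred 1+b≤1+k))))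
             (ℚP.+-identityʳ _))

ΣPartitions-byMultiplicity : ∀ b d F →
  ΣPartitions (suc b) d F
    ≡ MonomialPowers.Σtᴮʳ (suc b) (s≤s z≤n) (λ r e → ΣPartitions b e (F ∘ (replicate r (suc b) ++_))) d
ΣPartitions-byMultiplicity b = <-rec _ byMultiplicity
  where
  B = suc b
  open MonomialPowers B (s≤s z≤n)
  Claim : ℕ → Set
  Claim d = ∀ F → ΣPartitions B d F ≡ Σtᴮʳ (λ r e → ΣPartitions b e (F ∘ (replicate r B ++_))) d
  byMultiplicity : ∀ d → (∀ {e} → e < d → Claim e) → Claim d
  byMultiplicity d smaller F = begin
    ΣPartitions B d F
      ≡⟨ ΣPartitions-suc b d F ⟩
    ΣPartitions b d F + guard≤ B d (ΣPartitions B (d ∸ B) (F ∘ (B ∷_)))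
      ≡⟨ cong (ΣPartitions b d F +_)
              (guard≤-cong B d (λ B≤d → smaller (ℕP.∸-monoʳ-< (s≤s z≤n) B≤d) (F ∘ (B ∷_)))) ⟩
    ΣPartitions b d F + guard≤ B d (Σtᴮʳ H (d ∸ B))
      ≡⟨ cong₂ _+_ (Σtᴮʳ-onlyAt0 (λ e → ΣPartitions b e F) d) (sym (tᴮ-Σtᴮʳ H d)) ⟨
    Σtᴮʳ (onlyAt0 (λ e → ΣPartitions b e F)) d + Σtᴮʳ (shiftIndex H) d
      ≡⟨ Σtᴮʳ-⊕ (onlyAt0 (λ e → ΣPartitions b e F)) (shiftIndex H) d ⟨
    Σtᴮʳ (λ r → onlyAt0 (λ e → ΣPartitions b e F) r ⊕ shiftIndex H r) d
      ≡⟨ Σtᴮʳ-cong merge d ⟩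
    Σtᴮʳ (λ r e → ΣPartitions b e (F ∘ (replicate r B ++_))) d ∎
    where
    H : ℕ → Series
    H r e = ΣPartitions b e (F ∘ (replicate (suc r) B ++_))
    merge : ∀ r e → onlyAt0 (λ e → ΣPartitions b e F) r e + shiftIndex H r e
                      ≡ ΣPartitions b e (F ∘ (replicate r B ++_))
    merge zero    e = ℚP.+-identityʳ _
    merge (suc r) e = ℚP.+-identityˡ _

binomial-factorials : ∀ a b → ((a ℕ.+ b) C a) ℕ.* (a ℕ.! ℕ.* b ℕ.!) ≡ (a ℕ.+ b) ℕ.!
binomial-factorials a b =
  subst (λ c → ((a ℕ.+ b) C a) ℕ.* (a ℕ.! ℕ.* c ℕ.!) ≡ (a ℕ.+ b) ℕ.!) (ℕP.m+n∸m≡n a b)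
    (trans (cong (ℕ._* (a ℕ.! ℕ.* (a ℕ.+ b ∸ a) ℕ.!)) (nCk≡n!/k![n-k]! (ℕP.m≤m+n a b)))
           (m/n*n≡m {{_}} (k![n∸k]!∣n! (ℕP.m≤m+n a b))))

∏! : List ℕ → ℕ
∏! ks = product (map ℕ._! ks)

∏!-nonZero : ∀ ks → ℕ.NonZero (∏! ks)
∏!-nonZero ks = ℕListP.product≢0 (AllP.map⁺ (All.universal (λ k → k ℕP.!≢0) ks))

multinomial-factorials : ∀ ks → multinomial ks ℕ.* ∏! ks ≡ (sum ks) ℕ.!
multinomial-factorials []       = refl
multinomial-factorials (k ∷ ks) = begin
  (Cₖ ℕ.* multinomial ks) ℕ.* (k ℕ.! ℕ.* ∏! ks)
    ≡⟨ solveℕ 4 (λ C M f P → (C ⊠ M) ⊠ (f ⊠ P) ≐ C ⊠ (f ⊠ (M ⊠ P))) refl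
          Cₖ (multinomial ks) (k ℕ.!) (∏! ks) ⟩
  Cₖ ℕ.* (k ℕ.! ℕ.* (multinomial ks ℕ.* ∏! ks))
    ≡⟨ cong (λ z → Cₖ ℕ.* (k ℕ.! ℕ.* z)) (multinomial-factorials ks) ⟩
  Cₖ ℕ.* (k ℕ.! ℕ.* (sum ks) ℕ.!)
    ≡⟨ binomial-factorials k (sum ks) ⟩
  (k ℕ.+ sum ks) ℕ.! ∎
  where Cₖ = (k ℕ.+ sum ks) C k

multinomial-snoc : ∀ q ms r → multinomial (q ∷ ms ++ (r ∷ [])) ≡ ((q ℕ.+ r) C r) ℕ.* multinomial ((q ℕ.+ r) ∷ ms)
multinomial-snoc q ms r = ℕP.*-cancelʳ-≡ _ _ (∏! ν) {{∏!-nonZero ν}} (begin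
  multinomial ν ℕ.* ∏! ν
    ≡⟨ multinomial-factorials ν ⟩
  (q ℕ.+ sum (ms ++ (r ∷ []))) ℕ.!
    ≡⟨ cong (λ s → (q ℕ.+ s) ℕ.!) (ℕListP.sum-++ ms (r ∷ [])) ⟩
  (q ℕ.+ (sum ms ℕ.+ (r ℕ.+ 0))) ℕ.!
    ≡⟨ cong ℕ._! (solveℕ 3 (λ q s r → q ⊞ (s ⊞ (r ⊞ conℕ 0)) ≐ (q ⊞ r) ⊞ s) refl q (sum ms) r) ⟩
  ((q ℕ.+ r) ℕ.+ sum ms) ℕ.!
    ≡⟨ multinomial-factorials ((q ℕ.+ r) ∷ ms) ⟨
  M ℕ.* ((q ℕ.+ r) ℕ.! ℕ.* ∏! ms)
    ≡⟨ cong (λ z → M ℕ.* (z ℕ.* ∏! ms)) binomial ⟨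
  M ℕ.* ((Cᵣ ℕ.* (r ℕ.! ℕ.* q ℕ.!)) ℕ.* ∏! ms)
    ≡⟨ solveℕ 5 (λ M C f g P → M ⊠ ((C ⊠ (f ⊠ g)) ⊠ P) ≐ (C ⊠ M) ⊠ (g ⊠ (P ⊠ (f ⊠ conℕ 1))))
          refl M Cᵣ (r ℕ.!) (q ℕ.!) (∏! ms) ⟩
  (Cᵣ ℕ.* M) ℕ.* (q ℕ.! ℕ.* (∏! ms ℕ.* (r ℕ.! ℕ.* 1)))
    ≡⟨ cong (λ z → (Cᵣ ℕ.* M) ℕ.* (q ℕ.! ℕ.* z))
         (trans (cong product (ListP.map-++ ℕ._! ms (r ∷ []))) (ℕListP.product-++ (map ℕ._! ms) (r ℕ.! ∷ []))) ⟨
  (Cᵣ ℕ.* M) ℕ.* ∏! ν ∎)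
  where
  ν = q ∷ ms ++ (r ∷ [])
  Cᵣ = (q ℕ.+ r) C r
  M = multinomial ((q ℕ.+ r) ∷ ms)
  binomial : Cᵣ ℕ.* (r ℕ.! ℕ.* q ℕ.!) ≡ (q ℕ.+ r) ℕ.!
  binomial rewrite ℕP.+-comm q r = binomial-factorials r q

range1-suc : ∀ b → range1 (suc (suc b)) ≡ range1 (suc b) ++ (suc b ∷ [])
range1-suc b = trans (cong (map suc) (sym (ListP.upTo-∷ʳ b))) (ListP.map-++ suc (upTo b) (b ∷ []))

range1-bounded : ∀ b → All (_≤ b) (range1 (suc b))
range1-bounded b = AllP.map⁺ (AllP.all-upTo b)

mult-++ : ∀ i xs ys → mult i (xs ++ ys) ≡ mult i xs ℕ.+ mult i ys
mult-++ i xs ys = trans (cong length (ListP.filter-++ (i ℕ.≟_) xs ys)) (ListP.length-++ (filter (i ℕ.≟_) xs))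

mult-replicate-≢ : ∀ {i B} r → ¬ i ≡ B → mult i (replicate r B) ≡ 0
mult-replicate-≢ zero    i≢B = refl
mult-replicate-≢ (suc r) i≢B = trans (cong length (ListP.filter-reject (_ ℕ.≟_) i≢B)) (mult-replicate-≢ r i≢B)

mult-replicate : ∀ B r → mult B (replicate r B) ≡ r
mult-replicate B zero    = refl
mult-replicate B (suc r) = trans (cong length (ListP.filter-accept (B ℕ.≟_) refl)) (cong suc (mult-replicate B r))

mult-absent : ∀ b μ → All (_≤ b) μ → mult (suc b) μ ≡ 0
mult-absent b []       []             = refl
mult-absent b (x ∷ xs) (x≤b ∷ xs≤b) =
  trans (cong length (ListP.filter-reject (suc b ℕ.≟_) {x = x} {xs = xs} (λ 1+b≡x → ℕP.<⇒≢ (s≤s x≤b) (sym 1+b≡x))))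
        (mult-absent b xs xs≤b)

∏ℚ : List ℚ → ℚ
∏ℚ = foldr _*_ 1ℚ

∏ℚ-snoc : ∀ xs y → ∏ℚ (xs ++ (y ∷ [])) ≡ ∏ℚ xs * y
∏ℚ-snoc []       y = trans (ℚP.*-identityʳ y) (sym (ℚP.*-identityˡ y))
∏ℚ-snoc (x ∷ xs) y rewrite ∏ℚ-snoc xs y = sym (ℚP.*-assoc x (∏ℚ xs) y)

module Weights (c : ℚ) (G : ℕ → ℕ) where

  -- For c = (-N)⁻¹, G i = C(N, i + 1), b = N - 1 and q = m - 1 this is the summand of the theorem.
  weight : ℕ → ℕ → List ℕ → ℚ
  weight b q μ = c ^ℚ length μ * ℕ→ℚ (multinomial (q ∷ map (λ i → mult i μ) (range1 (suc b))))
                 * ∏ℚ (map (λ i → ℕ→ℚ (G i ℕ.^ mult i μ)) (range1 (suc b)))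

  a : ℕ → ℚ
  a j = c * ℕ→ℚ (G j)

  multiplicities-replicate : ∀ {X : Set} (h : ℕ → ℕ → X) b r μ → All (_≤ b) μ →
    map (λ i → h i (mult i (replicate r (suc b) ++ μ))) (range1 (suc (suc b)))
      ≡ map (λ i → h i (mult i μ)) (range1 (suc b)) ++ (h (suc b) r ∷ [])
  multiplicities-replicate h b r μ μ≤b = begin
    map f (range1 (suc (suc b)))
      ≡⟨ cong (map f) (range1-suc b) ⟩
    map f (range1 (suc b) ++ (suc b ∷ []))
      ≡⟨ ListP.map-++ f (range1 (suc b)) (suc b ∷ []) ⟩
    map f (range1 (suc b)) ++ (f (suc b) ∷ [])
      ≡⟨ cong₂ _++_ (ListP.map-cong-local (All.map old (range1-bounded b))) (cong (_∷ []) new) ⟩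
    map (λ i → h i (mult i μ)) (range1 (suc b)) ++ (h (suc b) r ∷ []) ∎
    where
    f = λ i → h i (mult i (replicate r (suc b) ++ μ))
    old : ∀ {i} → i ≤ b → f i ≡ h i (mult i μ)
    old {i} i≤b = cong (h i) (trans (mult-++ i (replicate r (suc b)) μ)
                    (cong (ℕ._+ mult i μ) (mult-replicate-≢ r (ℕP.<⇒≢ (s≤s i≤b)))))
    new : f (suc b) ≡ h (suc b) r
    new = cong (h (suc b)) (trans (mult-++ (suc b) (replicate r (suc b)) μ)
            (trans (cong₂ ℕ._+_ (mult-replicate (suc b) r) (mult-absent b μ μ≤b)) (ℕP.+-identityʳ r)))

  weight-replicate : ∀ b q r μ → All (_≤ b) μ →
    weight (suc b) q (replicate r (suc b) ++ μ) ≡ ℕ→ℚ ((q ℕ.+ r) C r) * (a (suc b) ^ℚ r) * weight b (q ℕ.+ r) μ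
  weight-replicate b q r μ μ≤b = begin
    weight (suc b) q ν
      ≡⟨ cong₂ _*_ (cong₂ _*_ powerFactor multinomialFactor) productFactor ⟩
    (c ^ℚ r * c ^ℚ length μ) * (Cᵣ * ℕ→ℚ M) * (P * ℕ→ℚ (G (suc b)) ^ℚ r)
      ≡⟨ solve 6 (λ cr cl C M P g → (cr :* cl) :* (C :* M) :* (P :* g) := C :* (cr :* g) :* (cl :* M :* P)) refl
           (c ^ℚ r) (c ^ℚ length μ) Cᵣ (ℕ→ℚ M) P (ℕ→ℚ (G (suc b)) ^ℚ r) ⟩
    Cᵣ * (c ^ℚ r * ℕ→ℚ (G (suc b)) ^ℚ r) * weight b (q ℕ.+ r) μ
      ≡⟨ cong (λ z → Cᵣ * z * weight b (q ℕ.+ r) μ) (^ℚ-distribʳ-* c (ℕ→ℚ (G (suc b))) r) ⟨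
    Cᵣ * (a (suc b) ^ℚ r) * weight b (q ℕ.+ r) μ ∎
    where
    ν  = replicate r (suc b) ++ μ
    ms = map (λ i → mult i μ) (range1 (suc b))
    M  = multinomial ((q ℕ.+ r) ∷ ms)
    P  = ∏ℚ (map (λ i → ℕ→ℚ (G i ℕ.^ mult i μ)) (range1 (suc b)))
    Cᵣ = ℕ→ℚ ((q ℕ.+ r) C r)
    powerFactor : c ^ℚ length ν ≡ c ^ℚ r * c ^ℚ length μ
    powerFactor = trans (cong (c ^ℚ_) (trans (ListP.length-++ (replicate r (suc b)))
                                             (cong (ℕ._+ length μ) (ListP.length-replicate r))))
                        (^ℚ-distribˡ-+-* c r (length μ))
    multinomialFactor : ℕ→ℚ (multinomial (q ∷ map (λ i → mult i ν) (range1 (suc (suc b))))) ≡ Cᵣ * ℕ→ℚ M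
    multinomialFactor = begin
      ℕ→ℚ (multinomial (q ∷ map (λ i → mult i ν) (range1 (suc (suc b)))))
        ≡⟨ cong (λ ks → ℕ→ℚ (multinomial (q ∷ ks))) (multiplicities-replicate (λ _ k → k) b r μ μ≤b) ⟩
      ℕ→ℚ (multinomial (q ∷ ms ++ (r ∷ [])))  ≡⟨ cong ℕ→ℚ (multinomial-snoc q ms r) ⟩
      ℕ→ℚ (((q ℕ.+ r) C r) ℕ.* M)            ≡⟨ ℕ→ℚ-homo-* ((q ℕ.+ r) C r) M ⟩
      Cᵣ * ℕ→ℚ M                              ∎
    productFactor : ∏ℚ (map (λ i → ℕ→ℚ (G i ℕ.^ mult i ν)) (range1 (suc (suc b))))
                      ≡ P * ℕ→ℚ (G (suc b)) ^ℚ r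
    productFactor = begin
      ∏ℚ (map (λ i → ℕ→ℚ (G i ℕ.^ mult i ν)) (range1 (suc (suc b))))
        ≡⟨ cong ∏ℚ (multiplicities-replicate (λ i k → ℕ→ℚ (G i ℕ.^ k)) b r μ μ≤b) ⟩
      ∏ℚ (map (λ i → ℕ→ℚ (G i ℕ.^ mult i μ)) (range1 (suc b)) ++ (ℕ→ℚ (G (suc b) ℕ.^ r) ∷ []))
        ≡⟨ ∏ℚ-snoc (map (λ i → ℕ→ℚ (G i ℕ.^ mult i μ)) (range1 (suc b))) _ ⟩
      P * ℕ→ℚ (G (suc b) ℕ.^ r)               ≡⟨ cong (P *_) (ℕ→ℚ-homo-^ (G (suc b)) r) ⟩
      P * ℕ→ℚ (G (suc b)) ^ℚ r ∎

  aPoly : ℕ → Series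
  aPoly zero    = λ _ → 0ℚ
  aPoly (suc b) = aPoly b ⊕ monomial (suc b) (a (suc b))

  aPoly-0 : ∀ b → aPoly b 0 ≡ 0ℚ
  aPoly-0 zero    = refl
  aPoly-0 (suc b) rewrite aPoly-0 b | monomial-other (suc b) (a (suc b)) {0} (λ ()) = refl

  aPoly-suc : ∀ b i → aPoly b (suc i) ≡ guard≤ (suc i) b (a (suc i))
  aPoly-suc zero    i = sym (guard≤-no {suc i} {0} (a (suc i)) (λ ()))
  aPoly-suc (suc b) i = byCases (suc i ℕ.≟ suc b)
    where
    top : aPoly (suc b) (suc b) ≡ guard≤ (suc b) (suc b) (a (suc b))
    top = begin
      aPoly b (suc b) + monomial (suc b) (a (suc b)) (suc b)
        ≡⟨ cong₂ _+_ (trans (aPoly-suc b b) (guard≤-no {suc b} _ ℕP.1+n≰n))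
                      (monomial-self (suc b) (a (suc b))) ⟩
      0ℚ + a (suc b)
        ≡⟨ ℚP.+-identityˡ _ ⟩
      a (suc b)
        ≡⟨ guard≤-yes (a (suc b)) (ℕP.≤-refl {suc b}) ⟨
      guard≤ (suc b) (suc b) (a (suc b)) ∎
    guard≤-bound : ¬ suc i ≡ suc b → Dec (suc i ≤ b) →
                   guard≤ (suc i) b (a (suc i)) ≡ guard≤ (suc i) (suc b) (a (suc i))
    guard≤-bound _        (yes 1+i≤b) = trans (guard≤-yes _ 1+i≤b) (sym (guard≤-yes _ (ℕP.m≤n⇒m≤1+n 1+i≤b)))
    guard≤-bound 1+i≢1+b (no 1+i≰b)  = trans (guard≤-no _ 1+i≰b)
      (sym (guard≤-no {suc i} _ (λ 1+i≤1+b → 1+i≰b (ℕP.≤-pred (ℕP.≤∧≢⇒< 1+i≤1+b 1+i≢1+b)))))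
    byCases : Dec (suc i ≡ suc b) → aPoly (suc b) (suc i) ≡ guard≤ (suc i) (suc b) (a (suc i))
    byCases (yes 1+i≡1+b) = subst (λ j → aPoly (suc b) j ≡ guard≤ j (suc b) (a j)) (sym 1+i≡1+b) top
    byCases (no 1+i≢1+b) = begin
      aPoly b (suc i) + monomial (suc b) (a (suc b)) (suc i)
        ≡⟨ cong₂ _+_ (aPoly-suc b i) (monomial-other (suc b) (a (suc b)) 1+i≢1+b) ⟩
      guard≤ (suc i) b (a (suc i)) + 0ℚ
        ≡⟨ ℚP.+-identityʳ _ ⟩
      guard≤ (suc i) b (a (suc i))
        ≡⟨ guard≤-bound 1+i≢1+b (suc i ℕ.≤? b) ⟩
      guard≤ (suc i) (suc b) (a (suc i)) ∎

  partitionSeries : ℕ → ℕ → Series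
  partitionSeries b zero       = constS 1ℚ
  partitionSeries b (suc q) d = ΣPartitions b d (weight b q)

  partitionSeries-invPowers : ∀ b → InvPowers (aPoly b) (partitionSeries b)
  partitionSeries-invPowers zero q d = trans (only-empty (suc q) d)
    (sym (trans (cong₂ _+_ (only-empty q d) (Σ≤-zero d (λ j _ → ℚP.*-zeroˡ (partitionSeries 0 (suc q) (d ∸ j)))))
                (ℚP.+-identityʳ _)))
    where
    only-empty : ∀ q → partitionSeries 0 q ≗ constS 1ℚ
    only-empty zero    d       = refl
    only-empty (suc q) zero    rewrite ℕP.+-identityʳ q | nCn≡1 q = refl
    only-empty (suc q) (suc k) = refl
  partitionSeries-invPowers (suc b) = InvPowers-congʳ {aPoly (suc b)} partitionSeries≗Z Z-invPowers
    where
    open AddMonomial (suc b) (s≤s z≤n) (aPoly b) (partitionSeries b) (partitionSeries-invPowers b) (λ _ → refl) (a (suc b))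
    open MonomialPowers (suc b) (s≤s z≤n)
    partitionSeries≗Z : ∀ q → partitionSeries (suc b) q ≗ Z q
    partitionSeries≗Z zero    d = refl
    partitionSeries≗Z (suc q) d = trans (ΣPartitions-byMultiplicity b d (weight (suc b) q)) (Σtᴮʳ-cong byMultiplicity d)
      where
      byMultiplicity : ∀ r e → ΣPartitions b e (weight (suc b) q ∘ (replicate r (suc b) ++_)) ≡ Zterm q r e
      byMultiplicity r e = trans (ΣPartitionsAux-cong e b e (weight-replicate b q r))
                                 (ΣPartitionsAux-*ˡ e b e (coeff q r) (weight b (q ℕ.+ r)))

-- ((1 + t)ᴺ - 1) / t = Σᵢ C(N, i + 1) tⁱ
polyAt1+t-geomPoly : ∀ N i → polyAt1+t (geomPoly N) i ≡ ℕ→ℚ (N C suc i)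
polyAt1+t-geomPoly zero    zero    = refl
polyAt1+t-geomPoly zero    (suc i) = refl
polyAt1+t-geomPoly (suc N) zero    = begin
  1ℚ + 1ℚ * P 0                  ≡⟨ cong (1ℚ +_) (trans (ℚP.*-identityˡ (P 0)) (polyAt1+t-geomPoly N 0)) ⟩
  1ℚ + ℕ→ℚ (N C 1)               ≡⟨ ℕ→ℚ-homo-+ 1 (N C 1) ⟨
  ℕ→ℚ (N C 0 ℕ.+ N C 1)         ≡⟨ cong ℕ→ℚ (nCk+nC[k+1]≡[n+1]C[k+1] N 0) ⟩
  ℕ→ℚ (suc N C 1)                ∎
  where P = polyAt1+t (geomPoly N)
polyAt1+t-geomPoly (suc N) (suc i) = begin
  0ℚ + Σ≤ (suc i) (λ j → onePlusT j * P (suc i ∸ j))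
    ≡⟨ ℚP.+-identityˡ _ ⟩
  Σ≤ (suc i) (λ j → onePlusT j * P (suc i ∸ j))
    ≡⟨ Σ≤-head i (λ j → onePlusT j * P (suc i ∸ j)) ⟩
  1ℚ * P (suc i) + Σ≤ i (λ j → onePlusT (suc j) * P (i ∸ j))
    ≡⟨ cong₂ _+_ (ℚP.*-identityˡ (P (suc i))) (Σ≤-head-only i (λ j → ℚP.*-zeroˡ (P (i ∸ suc j)))) ⟩
  P (suc i) + 1ℚ * P i
    ≡⟨ cong₂ _+_ (polyAt1+t-geomPoly N (suc i)) (trans (ℚP.*-identityˡ (P i)) (polyAt1+t-geomPoly N i)) ⟩
  ℕ→ℚ (N C suc (suc i)) + ℕ→ℚ (N C suc i)
    ≡⟨ ℚP.+-comm (ℕ→ℚ (N C suc (suc i))) (ℕ→ℚ (N C suc i)) ⟩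
  ℕ→ℚ (N C suc i) + ℕ→ℚ (N C suc (suc i))
    ≡⟨ ℕ→ℚ-homo-+ (N C suc i) (N C suc (suc i)) ⟨
  ℕ→ℚ (N C suc i ℕ.+ N C suc (suc i))
    ≡⟨ cong ℕ→ℚ (nCk+nC[k+1]≡[n+1]C[k+1] N (suc i)) ⟩
  ℕ→ℚ (suc N C suc (suc i)) ∎
  where P = polyAt1+t (geomPoly N)

-- summand p n m as a function of N = pⁿ
summandAt : ℕ → ℕ → List ℕ → ℚ
summandAt N m μ =
  recip ((- ℕ→ℚ N) ^ℚ ℓ μ)
  * ℕ→ℚ (multinomial ((m ∸ 1) ∷ map (λ i → mult i μ) (range1 N)))
  * List.foldr _*_ 1ℚ (map (λ i → ℕ→ℚ ((N C (suc i)) ℕ.^ mult i μ)) (range1 N))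

-- With g(t) = Σᵢ C(N, i+1) tⁱ we have g(t) = N (1 - A(t)) where A = Σ_{1≤j<N} aⱼ tʲ and aⱼ = -C(N, j+1)/N,
-- so g⁻ᵐ = N⁻ᵐ (1 - A)⁻ᵐ is the partition series of A.
module Expansion (N′ : ℕ) where
  N = suc N′
  open Weights (recip (- ℕ→ℚ N)) (λ i → N C suc i)

  g : Series
  g = polyAt1+t (geomPoly N)

  g0≡N : g 0 ≡ ℕ→ℚ N
  g0≡N = trans (polyAt1+t-geomPoly N 0) (cong ℕ→ℚ (nC1≡n N))

  N≢0 : ¬ ℕ→ℚ N ≡ 0ℚ
  N≢0 = ℕ→ℚ-suc≢0 N′

  -- invS g is by definition scaleS (recip (g 0)) (geometric A).
  A : Series
  A = negS (scaleS (recip (g 0)) g ⊕ negS (constS 1ℚ))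

  A0≡0 : A 0 ≡ 0ℚ
  A0≡0 = cong (λ x → - (x + - 1ℚ)) (recip-inverseˡ (g 0) (λ g0≡0 → N≢0 (trans (sym g0≡N) g0≡0)))

  aPoly≗A : aPoly N′ ≗ A
  aPoly≗A zero    = trans (aPoly-0 N′) (sym A0≡0)
  aPoly≗A (suc i) = begin
    aPoly N′ (suc i)
      ≡⟨ aPoly-suc N′ i ⟩
    guard≤ (suc i) N′ (a (suc i))
      ≡⟨ outOfRange (suc i ℕ.≤? N′) ⟩
    a (suc i)
      ≡⟨ cong (_* Cᵢ) (recip-neg (ℕ→ℚ N) N≢0) ⟩
    (- recip (ℕ→ℚ N)) * Cᵢ
      ≡⟨ solve 2 (λ r x → (:- r) :* x := :- (r :* x :+ :- con 0ℚ)) refl (recip (ℕ→ℚ N)) Cᵢ ⟩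
    - (recip (ℕ→ℚ N) * Cᵢ + - 0ℚ)
      ≡⟨ cong₂ (λ x y → - (recip x * y + - 0ℚ)) g0≡N (polyAt1+t-geomPoly N (suc i)) ⟨
    A (suc i) ∎
    where
    Cᵢ = ℕ→ℚ (N C suc (suc i))
    outOfRange : Dec (suc i ≤ N′) → guard≤ (suc i) N′ (a (suc i)) ≡ a (suc i)
    outOfRange (yes 1+i≤N′) = guard≤-yes _ 1+i≤N′
    outOfRange (no 1+i≰N′)  = trans (guard≤-no _ 1+i≰N′) (sym (trans
      (cong (λ k → recip (- ℕ→ℚ N) * ℕ→ℚ k) (k>n⇒nCk≡0 (s≤s (ℕP.≰⇒> 1+i≰N′))))
      (ℚP.*-zeroʳ (recip (- ℕ→ℚ N)))))

  powS-geometric≗partitionSeries : ∀ q → powS (geometric A) q ≗ partitionSeries N′ q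
  powS-geometric≗partitionSeries = InvPowers-unique {A} A0≡0 (powS-geometric-invPowers A A0≡0)
    (InvPowers-congˡ {aPoly N′} {A} {partitionSeries N′} aPoly≗A (partitionSeries-invPowers N′)) (λ _ → refl)

  weight≡summandAt : ∀ m′ μ → weight N′ m′ μ ≡ summandAt N (suc m′) μ
  weight≡summandAt m′ μ = cong (λ x → x * ℕ→ℚ (multinomial (m′ ∷ map (λ i → mult i μ) (range1 N)))
                                        * ∏ℚ (map (λ i → ℕ→ℚ ((N C suc i) ℕ.^ mult i μ)) (range1 N)))
                               (sym (recip-^ℚ (- ℕ→ℚ N) (length μ) (λ -N≡0 → N≢0 (ℚP.neg-injective -N≡0))))

  recip-ℕ→ℚ-^ : ∀ m → recip (ℕ→ℚ (N ℕ.^ m)) ≡ recip (ℕ→ℚ N) ^ℚ m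
  recip-ℕ→ℚ-^ m = trans (cong recip (ℕ→ℚ-homo-^ N m)) (recip-^ℚ (ℕ→ℚ N) m N≢0)

  expansion : ∀ m′ d → powS (invS g) (suc m′) d
                         ≡ recip (ℕ→ℚ (N ℕ.^ suc m′)) * sumMap (summandAt N (suc m′)) (partitionsAux d N′ d)
  expansion m′ d = begin
    powS (scaleS (recip (g 0)) (geometric A)) (suc m′) d
      ≡⟨ powS-scale (recip (g 0)) (geometric A) (suc m′) d ⟩
    recip (g 0) ^ℚ suc m′ * powS (geometric A) (suc m′) d
      ≡⟨ cong₂ (λ x y → recip x ^ℚ suc m′ * y) g0≡N
               (powS-geometric≗partitionSeries (suc m′) d) ⟩
    recip (ℕ→ℚ N) ^ℚ suc m′ * ΣPartitions N′ d (weight N′ m′)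
      ≡⟨ cong₂ _*_ (sym (recip-ℕ→ℚ-^ (suc m′))) partitionSum ⟩
    recip (ℕ→ℚ (N ℕ.^ suc m′)) * sumMap (summandAt N (suc m′)) (partitionsAux d N′ d) ∎
    where
    partitionSum : ΣPartitions N′ d (weight N′ m′) ≡ sumMap (summandAt N (suc m′)) (partitionsAux d N′ d)
    partitionSum = trans (sym (sumMap-partitionsAux d N′ d (weight N′ m′)))
                         (cong (foldr _+_ 0ℚ) (ListP.map-cong (weight≡summandAt m′) (partitionsAux d N′ d)))

taylorNegPow-expansion : ∀ N → .{{ℕ.NonZero N}} → ∀ m′ d →
  powS (invS (polyAt1+t (geomPoly N))) (suc m′) d
    ≡ recip (ℕ→ℚ (N ℕ.^ suc m′)) * sumMap (summandAt N (suc m′)) (partitionsAux d (N ∸ 1) d)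
taylorNegPow-expansion (suc N′) = Expansion.expansion N′

proposition2p15 : (p : ℕ) → 2 ≤ p → (n m k : ℕ) → 1 ≤ k → k ≤ m →
    𝕍 p m k n ≡ rhs p m k n
proposition2p15 p 2≤p n zero     k 1≤k k≤0 = ⊥-elim (ℕP.<⇒≱ 1≤k k≤0)
proposition2p15 p 2≤p n (suc m′) k _   _   = begin
  𝕍 p (suc m′) k n
    ≡⟨ taylorNegPow-expansion (p ℕ.^ n) {{pⁿ≢0}} m′ (suc m′ ∸ k) ⟩
  recip (ℕ→ℚ ((p ℕ.^ n) ℕ.^ suc m′)) * Σsummands
    ≡⟨ cong (λ e → recip (ℕ→ℚ e) * Σsummands) (ℕP.^-*-assoc p n (suc m′)) ⟩
  rhs p (suc m′) k n ∎
  where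
  Σsummands = sumMap (summand p n (suc m′)) (Π p n (suc m′ ∸ k))
  pⁿ≢0 : ℕ.NonZero (p ℕ.^ n)
  pⁿ≢0 = ℕP.m^n≢0 p n {{ℕ.>-nonZero (ℕP.<-trans (s≤s z≤n) 2≤p)}}
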